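{- For every W-logic $\mathsf{WL}$, the set of theorems of $\mathsf{WL}$ is decidable: given a formula $A$ of $\mathcal L$, it is decidable whether $\mathsf{WL}\vdash A$.
   Context: The language $\mathcal{L}$ consists of the formulas built from a countable set of propositional variables by $A ::= p \mid \bot \mid A\land A \mid A\lor A \mid A\to A \mid \Box A \mid \Diamond A$; $\top := \bot\to\bot$, $\neg A := A\to\bot$. Axiom schemes and rules (for all $A,B$): (Mon$_\Box$) from $A\to B$ infer $\Box A\to\Box B$; (Mon$_\Diamond$) from $A\to B$ infer $\Diamond A\to\Diamond B$; (C$_\Box$) $\Box A\land\Box B\to\Box(A\land B)$; (K$_\Diamond$) $\Box(A\to B)\to(\Diamond A\to\Diamond B)$; (N$_\Box$) $\Box\top$; (T$_\Box$) $\Box A\to A$; (T$_\Diamond$) $A\to\Diamond A$; (D) $\Box A\to\Diamond A$; (P$_\Diamond$) $\Diamond\top$; (Dual$_\land$) $\neg(\Box A\land\Diamond\neg A)$. The W-logics are obtained by adding to an axiomatisation of intuitionistic propositional logic (all $\mathcal L$-instances, with modus ponens): $\mathsf{WM}$ := Dual$_\land$ + Mon$_\Box$ + Mon$_\Diamond$; $\mathsf{WMN}$ := $\mathsf{WM}$+N$_\Box$; $\mathsf{WMC}$ := $\mathsf{WM}$+C$_\Box$+K$_\Diamond$; $\mathsf{WK}$ := $\mathsf{WMC}$+N$_\Box$; $\mathsf{WMP}$ := $\mathsf{WM}$+P$_\Diamond$; $\mathsf{WMNP}$ := $\mathsf{WMN}$+P$_\Diamond$; $\mathsf{WMD}$ :=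 $\mathsf{WM}$+D+P$_\Diamond$; $\mathsf{WMND}$ := $\mathsf{WMN}$+D; $\mathsf{WMCD}$ := $\mathsf{WMC}$+D+P$_\Diamond$; $\mathsf{WKD}$ := $\mathsf{WK}$+D; $\mathsf{WMT}$, $\mathsf{WMNT}$, $\mathsf{WMCT}$, $\mathsf{WKT}$ := respectively $\mathsf{WM}$, $\mathsf{WMN}$, $\mathsf{WMC}$, $\mathsf{WK}$ + T$_\Box$ + T$_\Diamond$. $\mathsf{WL}\vdash A$ means $A$ is derivable from axiom instances of $\mathsf{WL}$ by modus ponens and the rules of $\mathsf{WL}$. -}

module Defs where

open import Data.Nat using (ℕ)
open import Data.Bool using (Bool; true; false; T)

infixr 5 _⇒_
infixr 6 _∨′_
infixr 7 _∧′_
data Form : Set where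
  var  : ℕ → Form
  ⊥′   : Form
  _∧′_ : Form → Form → Form
  _∨′_ : Form → Form → Form
  _⇒_  : Form → Form → Form
  □    : Form → Form
  ◇    : Form → Form

⊤′ : Form
⊤′ = ⊥′ ⇒ ⊥′

¬′ : Form → Form
¬′ A = A ⇒ ⊥′

data WLogic : Set where
  WM WMN WMC WK WMP WMNP WMD WMND WMCD WKD WMT WMNT WMCT WKT : WLogic

-- which optional axioms each logic contains
-- hasN : N□ ; hasC : C□ and K◇ ; hasP : P◇ ; hasD : D ; hasT : T□ and T◇
hasN hasC hasP hasD hasT : WLogic → Bool
hasN WMN  = true
hasN WK   = true
hasN WMNP = true
hasN WMND = true
hasN WKD  = true
hasN WMNT = true
hasN WKT  = true
hasN _    = false

hasC WMC  = true
hasC WK   = true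
hasC WMCD = true
hasC WKD  = true
hasC WMCT = true
hasC WKT  = true
hasC _    = false

hasP WMP  = true
hasP WMNP = true
hasP WMD  = true
hasP WMCD = true
hasP _    = false

hasD WMD  = true
hasD WMND = true
hasD WMCD = true
hasD WKD  = true
hasD _    = false

hasT WMT  = true
hasT WMNT = true
hasT WMCT = true
hasT WKT  = true
hasT _    = false

infix 3 _⊢_
data _⊢_ (L : WLogic) : Form → Set where
  ax-K   : ∀ {A B} → L ⊢ A ⇒ B ⇒ A
  ax-S   : ∀ {A B C} → L ⊢ (A ⇒ B ⇒ C) ⇒ (A ⇒ B) ⇒ A ⇒ C
  ax-∧E₁ : ∀ {A B} → L ⊢ A ∧′ B ⇒ A
  ax-∧E₂ : ∀ {A B} → L ⊢ A ∧′ B ⇒ B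
  ax-∧I  : ∀ {A B} → L ⊢ A ⇒ B ⇒ A ∧′ B
  ax-∨I₁ : ∀ {A B} → L ⊢ A ⇒ A ∨′ B
  ax-∨I₂ : ∀ {A B} → L ⊢ B ⇒ A ∨′ B
  ax-∨E  : ∀ {A B C} → L ⊢ (A ⇒ C) ⇒ (B ⇒ C) ⇒ A ∨′ B ⇒ C
  ax-⊥E  : ∀ {A} → L ⊢ ⊥′ ⇒ A
  mp     : ∀ {A B} → L ⊢ A ⇒ B → L ⊢ A → L ⊢ B
  dual∧  : ∀ {A} → L ⊢ ¬′ (□ A ∧′ ◇ (¬′ A))
  mon□   : ∀ {A B} → L ⊢ A ⇒ B → L ⊢ □ A ⇒ □ B
  mon◇   : ∀ {A B} → L ⊢ A ⇒ B → L ⊢ ◇ A ⇒ ◇ B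
  N□     : T (hasN L) → L ⊢ □ ⊤′
  C□     : ∀ {A B} → T (hasC L) → L ⊢ □ A ∧′ □ B ⇒ □ (A ∧′ B)
  K◇     : ∀ {A B} → T (hasC L) → L ⊢ □ (A ⇒ B) ⇒ ◇ A ⇒ ◇ B
  P◇     : T (hasP L) → L ⊢ ◇ ⊤′
  D      : ∀ {A} → T (hasD L) → L ⊢ □ A ⇒ ◇ A
  T□     : ∀ {A} → T (hasT L) → L ⊢ □ A ⇒ A
  T◇     : ∀ {A} → T (hasT L) → L ⊢ A ⇒ ◇ A

module Submission where

-- Each W-logic L has a cut-free sequent calculus: besides the intuitionistic rules, its modal
-- rules pass from boxes □Σ in the context (and possibly one ◇A) to the unboxed formulas, under a
-- condition on |Σ| recording which of the axioms N, C, D, P that instance needs. Cut is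
-- admissible, by induction on the cut formula and then on the two derivations; a principal cut
-- merges the boxed contexts of both rules, and the merged conditions still hold (using that
-- every logic with P and C also has D). So the calculus derives exactly the theorems of L. Its
-- rules have the subformula property and contexts only matter as sets, so the sequents relevant
-- to a formula A are finitely many; the derivable ones among them form the least set closed
-- under single rule applications, which is computed by saturation.

open import Defs
open import Data.Bool using (T)
open import Data.Empty using (⊥; ⊥-elim)
open import Data.List using (List; []; _∷_; _++_; length; map; filter; deduplicate; cartesianProduct)
open import Data.List.Properties using (length-filter; filter-notAll; length-++)
  renaming (≡-dec to List-≡-dec)
open import Data.List.Membership.Propositional using (_∈_; _∉_; find; lose)
open import Data.List.Membership.Propositional.Properties
  using (∈-++⁺ˡ; ∈-++⁺ʳ; ∈-++⁻; ∈-map⁺; ∈-filter⁺; ∈-filter⁻; ∈-deduplicate⁺; ∈-cartesianProduct⁺)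
open import Data.List.Relation.Binary.Subset.Propositional using (_⊆_)
open import Data.List.Relation.Binary.Subset.Propositional.Properties using (⊆-refl; ∷⁺ʳ; ∈-∷⁺ʳ)
open import Data.List.Relation.Unary.Any using (Any; here; there; any?)
import Data.List.Relation.Unary.All as All
open import Data.List.Relation.Unary.Unique.Propositional using (Unique; []; _∷_)
import Data.List.Relation.Unary.Unique.Propositional.Properties as Unique
import Data.List.Relation.Unary.Unique.DecPropositional.Properties as UniqueDec
open import Data.Nat as ℕ using (ℕ; zero; suc; _+_; _≤_; _<_; z≤n; s≤s)
open import Data.Nat.Properties using (<-≤-trans; <⇒≤; m≤n⇒m≤1+n)
open import Data.Product using (_×_; _,_; proj₁; proj₂; ∃; uncurry)
open import Data.Product.Properties using () renaming (≡-dec to ×-≡-dec)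
open import Data.Sum using (_⊎_; inj₁; inj₂)
open import Data.Unit using (⊤; tt)
open import Function using (_∘_)
open import Relation.Binary.Definitions using (DecidableEquality)
open import Relation.Binary.PropositionalEquality using (_≡_; _≢_; refl; sym; cong; cong₂; subst)
open import Relation.Nullary using (Dec; yes; no; ¬_; ¬?)
open import Relation.Nullary.Decidable using (map′; _×-dec_; _⊎-dec_; T?)
open import Relation.Unary using (Decidable)

module _ {A : Set} where

  length-filter-mono : {P Q : A → Set} (P? : Decidable P) (Q? : Decidable Q) →
                       (∀ {x} → P x → Q x) → ∀ xs → length (filter P? xs) ≤ length (filter Q? xs)
  length-filter-mono P? Q? P⇒Q [] = z≤n
  length-filter-mono P? Q? P⇒Q (x ∷ xs) with P? x | Q? x
  ... | yes _  | yes _  = s≤s (length-filter-mono P? Q? P⇒Q xs)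
  ... | yes px | no ¬qx = ⊥-elim (¬qx (P⇒Q px))
  ... | no _   | yes _  = m≤n⇒m≤1+n (length-filter-mono P? Q? P⇒Q xs)
  ... | no _   | no _   = length-filter-mono P? Q? P⇒Q xs

  length-filter-strictMono : {P Q : A → Set} (P? : Decidable P) (Q? : Decidable Q) →
                             (∀ {x} → P x → Q x) → ∀ {y} xs → y ∈ xs → Q y → ¬ P y →
                             length (filter P? xs) < length (filter Q? xs)
  length-filter-strictMono P? Q? P⇒Q (x ∷ xs) (here refl) qy ¬py with P? x | Q? x
  ... | yes py | _      = ⊥-elim (¬py py)
  ... | no _   | yes _  = s≤s (length-filter-mono P? Q? P⇒Q xs)
  ... | no _   | no ¬qy = ⊥-elim (¬qy qy)
  length-filter-strictMono P? Q? P⇒Q (x ∷ xs) (there y∈) qy ¬py with P? x | Q? x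
  ... | yes _  | yes _  = s≤s (length-filter-strictMono P? Q? P⇒Q xs y∈ qy ¬py)
  ... | yes px | no ¬qx = ⊥-elim (¬qx (P⇒Q px))
  ... | no _   | yes _  = m≤n⇒m≤1+n (length-filter-strictMono P? Q? P⇒Q xs y∈ qy ¬py)
  ... | no _   | no _   = length-filter-strictMono P? Q? P⇒Q xs y∈ qy ¬py

  filter-cong : {P Q : A → Set} (P? : Decidable P) (Q? : Decidable Q) → ∀ xs →
                (∀ {x} → x ∈ xs → P x → Q x) → (∀ {x} → x ∈ xs → Q x → P x) → filter P? xs ≡ filter Q? xs
  filter-cong P? Q? [] _ _ = refl
  filter-cong P? Q? (x ∷ xs) P⇒Q Q⇒P with P? x | Q? x
  ... | yes _  | yes _  = cong (x ∷_) (filter-cong P? Q? xs (P⇒Q ∘ there) (Q⇒P ∘ there))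
  ... | no _   | no _   = filter-cong P? Q? xs (P⇒Q ∘ there) (Q⇒P ∘ there)
  ... | yes px | no ¬qx = ⊥-elim (¬qx (P⇒Q (here refl) px))
  ... | no ¬px | yes qx = ⊥-elim (¬px (Q⇒P (here refl) qx))

  sublists : List A → List (List A)
  sublists [] = [] ∷ []
  sublists (x ∷ xs) = map (x ∷_) (sublists xs) ++ sublists xs

  filter∈sublists : {P : A → Set} (P? : Decidable P) → ∀ xs → filter P? xs ∈ sublists xs
  filter∈sublists P? [] = here refl
  filter∈sublists P? (x ∷ xs) with P? x
  ... | yes _ = ∈-++⁺ˡ (∈-map⁺ (x ∷_) (filter∈sublists P? xs))
  ... | no _  = ∈-++⁺ʳ (map (x ∷_) (sublists xs)) (filter∈sublists P? xs)

module WithDecidableEquality {A : Set} (_≟ₐ_ : DecidableEquality A) where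

  infixl 6 _∖_
  _∖_ : List A → A → List A
  xs ∖ x = filter (λ y → ¬? (y ≟ₐ x)) xs

  ∈-∖⁻ : ∀ {x y} xs → y ∈ xs ∖ x → y ∈ xs × y ≢ x
  ∈-∖⁻ xs = ∈-filter⁻ (λ y → ¬? (y ≟ₐ _))

  ∈-∖⁺ : ∀ {x y xs} → y ∈ xs → y ≢ x → y ∈ xs ∖ x
  ∈-∖⁺ = ∈-filter⁺ (λ y → ¬? (y ≟ₐ _))

  length-∖-< : ∀ {x} xs → x ∈ xs → length (xs ∖ x) < length xs
  length-∖-< {x} xs x∈ = filter-notAll (λ y → ¬? (y ≟ₐ x)) xs (lose x∈ (λ x≢x → x≢x refl))

  unique-⊆⇒length-≤ : ∀ {xs ys} → Unique xs → xs ⊆ ys → length xs ≤ length ys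
  unique-⊆⇒length-≤ [] _ = z≤n
  unique-⊆⇒length-≤ {x ∷ xs} {ys} (x≢xs ∷ unique) x∷xs⊆ys =
    <-≤-trans (s≤s (unique-⊆⇒length-≤ unique xs⊆ys∖x)) (length-∖-< ys (x∷xs⊆ys (here refl)))
    where
    xs⊆ys∖x : xs ⊆ ys ∖ x
    xs⊆ys∖x y∈ = ∈-∖⁺ (x∷xs⊆ys (there y∈)) (λ { refl → All.lookup x≢xs y∈ refl })

-- The least subset of a finite universe closed under a decidable rule: each round adds all
-- fresh items, so the number of unknown items decreases and |universe| rounds suffice.
module Saturation {A : Set} (_≟ₐ_ : DecidableEquality A) (universe : List A)
                  (Rule : List A → A → Set) (rule? : ∀ K x → Dec (Rule K x)) where

  open import Data.List.Membership.DecPropositional _≟ₐ_ using (_∈?_; _∉?_)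

  fresh : List A → List A
  fresh K = filter (λ x → x ∉? K ×-dec rule? K x) universe

  unknown : List A → ℕ
  unknown K = length (filter (_∉? K) universe)

  saturate : ℕ → List A → List A
  saturate zero K = K
  saturate (suc n) K with fresh K
  ... | [] = K
  ... | x ∷ xs = saturate n (x ∷ xs ++ K)

  saturated : List A
  saturated = saturate (suc (length universe)) []

  ∈-fresh⁻ : ∀ {K x} → x ∈ fresh K → x ∈ universe × x ∉ K × Rule K x
  ∈-fresh⁻ = ∈-filter⁻ (λ x → _ ∉? _ ×-dec rule? _ x)

  module _ (P : A → Set) (rule-preserves : ∀ {K x} → (∀ {y} → y ∈ K → P y) → Rule K x → P x) where

    saturate-preserves : ∀ n K → (∀ {y} → y ∈ K → P y) → ∀ {y} → y ∈ saturate n K → P y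
    saturate-preserves zero K PK = PK
    saturate-preserves (suc n) K PK with fresh K in eq
    ... | [] = PK
    ... | x ∷ xs = saturate-preserves n (x ∷ xs ++ K) PK′
      where
      PK′ : ∀ {y} → y ∈ x ∷ xs ++ K → P y
      PK′ y∈ with ∈-++⁻ (x ∷ xs) y∈
      ... | inj₁ y∈fresh = rule-preserves PK (proj₂ (proj₂ (∈-fresh⁻ (subst (_ ∈_) (sym eq) y∈fresh))))
      ... | inj₂ y∈K     = PK y∈K

    saturated-sound : ∀ {x} → x ∈ saturated → P x
    saturated-sound = saturate-preserves (suc (length universe)) [] (λ ())

  Closed : List A → Set
  Closed K = ∀ {x} → x ∈ universe → Rule K x → x ∈ K

  nothing-fresh⇒closed : ∀ {K} → fresh K ≡ [] → Closed K
  nothing-fresh⇒closed {K} eq {x} x∈U rule with x ∈? K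
  ... | yes x∈K = x∈K
  ... | no x∉K with subst (x ∈_) eq (∈-filter⁺ (λ x → x ∉? K ×-dec rule? K x) x∈U (x∉K , rule))
  ...   | ()

  unknown-< : ∀ {K K′ x} → K ⊆ K′ → x ∈ universe → x ∉ K → x ∈ K′ → unknown K′ < unknown K
  unknown-< {K} {K′} K⊆K′ x∈U x∉K x∈K′ =
    length-filter-strictMono (_∉? K′) (_∉? K) (λ x∉K′ x∈K → x∉K′ (K⊆K′ x∈K)) universe x∈U x∉K
                             (λ x∉K′ → x∉K′ x∈K′)

  saturate-closed : ∀ n K → unknown K < n → Closed (saturate n K)
  saturate-closed (suc n) K (s≤s unknown≤n) with fresh K in eq
  ... | [] = nothing-fresh⇒closed eq
  ... | x ∷ xs = saturate-closed n (x ∷ xs ++ K) (<-≤-trans shrinks unknown≤n)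
    where
    x-new : x ∈ universe × x ∉ K × Rule K x
    x-new = ∈-fresh⁻ (subst (x ∈_) (sym eq) (here refl))

    shrinks : unknown (x ∷ xs ++ K) < unknown K
    shrinks = unknown-< (∈-++⁺ʳ (x ∷ xs)) (proj₁ x-new) (proj₁ (proj₂ x-new)) (here refl)

  saturated-closed : Closed saturated
  saturated-closed = saturate-closed (suc (length universe)) [] (s≤s (length-filter (_∉? []) universe))

infix 4 _≟_
_≟_ : DecidableEquality Form
var m ≟ var n = map′ (cong var) (λ { refl → refl }) (m ℕ.≟ n)
⊥′ ≟ ⊥′ = yes refl
(A ∧′ B) ≟ (A′ ∧′ B′) = map′ (uncurry (cong₂ _∧′_)) (λ { refl → refl , refl }) (A ≟ A′ ×-dec B ≟ B′)
(A ∨′ B) ≟ (A′ ∨′ B′) = map′ (uncurry (cong₂ _∨′_)) (λ { refl → refl , refl }) (A ≟ A′ ×-dec B ≟ B′)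
(A ⇒ B) ≟ (A′ ⇒ B′) = map′ (uncurry (cong₂ _⇒_)) (λ { refl → refl , refl }) (A ≟ A′ ×-dec B ≟ B′)
□ A ≟ □ B = map′ (cong □) (λ { refl → refl }) (A ≟ B)
◇ A ≟ ◇ B = map′ (cong ◇) (λ { refl → refl }) (A ≟ B)
var _ ≟ ⊥′ = no λ ()
var _ ≟ (_ ∧′ _) = no λ ()
var _ ≟ (_ ∨′ _) = no λ ()
var _ ≟ (_ ⇒ _) = no λ ()
var _ ≟ □ _ = no λ ()
var _ ≟ ◇ _ = no λ ()
⊥′ ≟ var _ = no λ ()
⊥′ ≟ (_ ∧′ _) = no λ ()
⊥′ ≟ (_ ∨′ _) = no λ ()
⊥′ ≟ (_ ⇒ _) = no λ ()
⊥′ ≟ □ _ = no λ ()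
⊥′ ≟ ◇ _ = no λ ()
(_ ∧′ _) ≟ var _ = no λ ()
(_ ∧′ _) ≟ ⊥′ = no λ ()
(_ ∧′ _) ≟ (_ ∨′ _) = no λ ()
(_ ∧′ _) ≟ (_ ⇒ _) = no λ ()
(_ ∧′ _) ≟ □ _ = no λ ()
(_ ∧′ _) ≟ ◇ _ = no λ ()
(_ ∨′ _) ≟ var _ = no λ ()
(_ ∨′ _) ≟ ⊥′ = no λ ()
(_ ∨′ _) ≟ (_ ∧′ _) = no λ ()
(_ ∨′ _) ≟ (_ ⇒ _) = no λ ()
(_ ∨′ _) ≟ □ _ = no λ ()
(_ ∨′ _) ≟ ◇ _ = no λ ()
(_ ⇒ _) ≟ var _ = no λ ()
(_ ⇒ _) ≟ ⊥′ = no λ ()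
(_ ⇒ _) ≟ (_ ∧′ _) = no λ ()
(_ ⇒ _) ≟ (_ ∨′ _) = no λ ()
(_ ⇒ _) ≟ □ _ = no λ ()
(_ ⇒ _) ≟ ◇ _ = no λ ()
□ _ ≟ var _ = no λ ()
□ _ ≟ ⊥′ = no λ ()
□ _ ≟ (_ ∧′ _) = no λ ()
□ _ ≟ (_ ∨′ _) = no λ ()
□ _ ≟ (_ ⇒ _) = no λ ()
□ _ ≟ ◇ _ = no λ ()
◇ _ ≟ var _ = no λ ()
◇ _ ≟ ⊥′ = no λ ()
◇ _ ≟ (_ ∧′ _) = no λ ()
◇ _ ≟ (_ ∨′ _) = no λ ()
◇ _ ≟ (_ ⇒ _) = no λ ()
◇ _ ≟ □ _ = no λ ()

open WithDecidableEquality _≟_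

infix 4 _≺_
data _≺_ : Form → Form → Set where
  ∧₁ : ∀ {A B} → A ≺ A ∧′ B
  ∧₂ : ∀ {A B} → B ≺ A ∧′ B
  ∨₁ : ∀ {A B} → A ≺ A ∨′ B
  ∨₂ : ∀ {A B} → B ≺ A ∨′ B
  ⇒₁ : ∀ {A B} → A ≺ A ⇒ B
  ⇒₂ : ∀ {A B} → B ≺ A ⇒ B
  □₁ : ∀ {A} → A ≺ □ A
  ◇₁ : ∀ {A} → A ≺ ◇ A


subformulas : Form → List Form
subformulas (var n) = var n ∷ []
subformulas ⊥′ = ⊥′ ∷ []
subformulas (A ∧′ B) = (A ∧′ B) ∷ subformulas A ++ subformulas B
subformulas (A ∨′ B) = (A ∨′ B) ∷ subformulas A ++ subformulas B
subformulas (A ⇒ B) = (A ⇒ B) ∷ subformulas A ++ subformulas B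
subformulas (□ A) = □ A ∷ subformulas A
subformulas (◇ A) = ◇ A ∷ subformulas A

∈-subformulas : ∀ A → A ∈ subformulas A
∈-subformulas (var _) = here refl
∈-subformulas ⊥′ = here refl
∈-subformulas (_ ∧′ _) = here refl
∈-subformulas (_ ∨′ _) = here refl
∈-subformulas (_ ⇒ _) = here refl
∈-subformulas (□ _) = here refl
∈-subformulas (◇ _) = here refl

≺⇒∈-subformulas : ∀ {A B} → A ≺ B → A ∈ subformulas B
≺⇒∈-subformulas {A} ∧₁ = there (∈-++⁺ˡ (∈-subformulas A))
≺⇒∈-subformulas {B} (∧₂ {A}) = there (∈-++⁺ʳ (subformulas A) (∈-subformulas B))
≺⇒∈-subformulas {A} ∨₁ = there (∈-++⁺ˡ (∈-subformulas A))
≺⇒∈-subformulas {B} (∨₂ {A}) = there (∈-++⁺ʳ (subformulas A) (∈-subformulas B))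
≺⇒∈-subformulas {A} ⇒₁ = there (∈-++⁺ˡ (∈-subformulas A))
≺⇒∈-subformulas {B} (⇒₂ {A}) = there (∈-++⁺ʳ (subformulas A) (∈-subformulas B))
≺⇒∈-subformulas {A} □₁ = there (∈-subformulas A)
≺⇒∈-subformulas {A} ◇₁ = there (∈-subformulas A)

subformulas-trans : ∀ C {B} → B ∈ subformulas C → subformulas B ⊆ subformulas C
subformulas-++-trans : ∀ A B {C} → C ∈ subformulas A ++ subformulas B →
                       subformulas C ⊆ subformulas A ++ subformulas B

subformulas-trans (var _) (here refl) = ⊆-refl
subformulas-trans ⊥′ (here refl) = ⊆-refl
subformulas-trans (A ∧′ B) (here refl) = ⊆-refl
subformulas-trans (A ∧′ B) (there C∈) = there ∘ subformulas-++-trans A B C∈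
subformulas-trans (A ∨′ B) (here refl) = ⊆-refl
subformulas-trans (A ∨′ B) (there C∈) = there ∘ subformulas-++-trans A B C∈
subformulas-trans (A ⇒ B) (here refl) = ⊆-refl
subformulas-trans (A ⇒ B) (there C∈) = there ∘ subformulas-++-trans A B C∈
subformulas-trans (□ A) (here refl) = ⊆-refl
subformulas-trans (□ A) (there C∈) = there ∘ subformulas-trans A C∈
subformulas-trans (◇ A) (here refl) = ⊆-refl
subformulas-trans (◇ A) (there C∈) = there ∘ subformulas-trans A C∈

subformulas-++-trans A B C∈ with ∈-++⁻ (subformulas A) C∈
... | inj₁ C∈A = ∈-++⁺ˡ ∘ subformulas-trans A C∈A
... | inj₂ C∈B = ∈-++⁺ʳ (subformulas A) ∘ subformulas-trans B C∈B

-- ⊥′ is included since the premises of ◇L and □L prove ⊥′.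
record SubformulaClosed (U : List Form) : Set where
  field
    ⊥∈ : ⊥′ ∈ U
    ≺-closed : ∀ {A B} → A ≺ B → B ∈ U → A ∈ U

subformulas-closed : ∀ A → SubformulaClosed (⊥′ ∷ subformulas A)
subformulas-closed A = record { ⊥∈ = here refl ; ≺-closed = closed }
  where
  closed : ∀ {B C} → B ≺ C → C ∈ ⊥′ ∷ subformulas A → B ∈ ⊥′ ∷ subformulas A
  closed () (here refl)
  closed B≺C (there C∈) = there (subformulas-trans A C∈ (≺⇒∈-subformulas B≺C))

-- An instance of a modal rule acting on the boxes □Σ of the context is guarded by the optional
-- axioms it uses, depending on n = |Σ|: to form □⋀Σ (N for n = 0, C for n ≥ 2), to combine it
-- with a ◇ by K◇ (part of C), or to pass from □ to ◇ (D, or P when nothing is boxed).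
□R-ok : WLogic → ℕ → Set
□R-ok L zero = T (hasN L)
□R-ok L (suc zero) = ⊤
□R-ok L (suc (suc _)) = T (hasC L)

◇R-ok : WLogic → ℕ → Set
◇R-ok L zero = ⊤
◇R-ok L (suc _) = T (hasC L)

◇Rᴰ-ok : WLogic → ℕ → Set
◇Rᴰ-ok L zero = T (hasP L) ⊎ T (hasD L) × T (hasN L)
◇Rᴰ-ok L (suc zero) = T (hasD L)
◇Rᴰ-ok L (suc (suc _)) = T (hasD L) × T (hasC L)

□L-ok : WLogic → ℕ → Set
□L-ok L zero = ⊤
□L-ok L (suc zero) = T (hasP L) ⊎ T (hasD L)
□L-ok L (suc (suc zero)) = T (hasD L)
□L-ok L (suc (suc (suc _))) = T (hasD L) × T (hasC L)

P∧C⇒D : ∀ L → T (hasP L) → T (hasC L) → T (hasD L)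
P∧C⇒D WMD  _ _ = tt
P∧C⇒D WMCD _ _ = tt
P∧C⇒D WMP  _ ()
P∧C⇒D WMNP _ ()
P∧C⇒D WM   ()
P∧C⇒D WMN  ()
P∧C⇒D WMC  ()
P∧C⇒D WK   ()
P∧C⇒D WMND ()
P∧C⇒D WKD  ()
P∧C⇒D WMT  ()
P∧C⇒D WMNT ()
P∧C⇒D WMCT ()
P∧C⇒D WKT  ()

-- Shrinking along ⊑ (m ≤ n, and m = 0 only if n = 0) preserves every modal side condition.
data _⊑_ : ℕ → ℕ → Set where
  zero : zero ⊑ zero
  suc  : ∀ {m n} → m ≤ n → suc m ⊑ suc n

⊇∧length-≤⇒⊑ : ∀ {A : Set} {xs ys : List A} → ys ⊆ xs → length xs ≤ length ys → length xs ⊑ length ys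
⊇∧length-≤⇒⊑ {xs = []} {[]} _ _ = zero
⊇∧length-≤⇒⊑ {xs = []} {_ ∷ _} ys⊆xs _ with ys⊆xs (here refl)
... | ()
⊇∧length-≤⇒⊑ {xs = _ ∷ _} {_ ∷ _} _ (s≤s xs≤ys) = suc xs≤ys

module SideConditions (L : WLogic) where

  □R-ok? : ∀ n → Dec (□R-ok L n)
  □R-ok? zero = T? _
  □R-ok? (suc zero) = yes tt
  □R-ok? (suc (suc _)) = T? _

  ◇R-ok? : ∀ n → Dec (◇R-ok L n)
  ◇R-ok? zero = yes tt
  ◇R-ok? (suc _) = T? _

  ◇Rᴰ-ok? : ∀ n → Dec (◇Rᴰ-ok L n)
  ◇Rᴰ-ok? zero = T? _ ⊎-dec T? _ ×-dec T? _
  ◇Rᴰ-ok? (suc zero) = T? _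
  ◇Rᴰ-ok? (suc (suc _)) = T? _ ×-dec T? _

  □L-ok? : ∀ n → Dec (□L-ok L n)
  □L-ok? zero = yes tt
  □L-ok? (suc zero) = T? _ ⊎-dec T? _
  □L-ok? (suc (suc zero)) = T? _
  □L-ok? (suc (suc (suc _))) = T? _ ×-dec T? _

  C⇒◇R-ok : ∀ n → T (hasC L) → ◇R-ok L n
  C⇒◇R-ok zero _ = tt
  C⇒◇R-ok (suc _) c = c

  C⇒□R-ok⁺ : ∀ n → T (hasC L) → □R-ok L (suc n)
  C⇒□R-ok⁺ zero _ = tt
  C⇒□R-ok⁺ (suc _) c = c

  D∧C⇒□L-ok : ∀ n → T (hasD L) → T (hasC L) → □L-ok L (suc (suc n))
  D∧C⇒□L-ok zero d _ = d
  D∧C⇒□L-ok (suc _) d c = d , c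

  ◇Rᴰ-ok⁺⇒D : ∀ n → ◇Rᴰ-ok L (suc n) → T (hasD L)
  ◇Rᴰ-ok⁺⇒D zero d = d
  ◇Rᴰ-ok⁺⇒D (suc _) (d , _) = d

  ◇Rᴰ-ok₀∧C⇒D : ◇Rᴰ-ok L zero → T (hasC L) → T (hasD L)
  ◇Rᴰ-ok₀∧C⇒D (inj₁ p) c = P∧C⇒D L p c
  ◇Rᴰ-ok₀∧C⇒D (inj₂ (d , _)) _ = d

  □L-ok₁∧C⇒D : □L-ok L 1 → T (hasC L) → T (hasD L)
  □L-ok₁∧C⇒D (inj₁ p) c = P∧C⇒D L p c
  □L-ok₁∧C⇒D (inj₂ d) _ = d

  □L-ok-anti⁺ : ∀ {m n} → m ≤ n → □L-ok L (suc n) → □L-ok L (suc m)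
  □L-ok-anti⁺ {zero}  {zero} _ ok = ok
  □L-ok-anti⁺ {zero}  {suc zero} _ d = inj₂ d
  □L-ok-anti⁺ {zero}  {suc (suc _)} _ (d , _) = inj₂ d
  □L-ok-anti⁺ {suc zero} {suc zero} _ d = d
  □L-ok-anti⁺ {suc zero} {suc (suc _)} _ (d , _) = d
  □L-ok-anti⁺ {suc (suc _)} {suc zero} (s≤s ())
  □L-ok-anti⁺ {suc (suc _)} {suc (suc _)} _ ok = ok

  □R-ok-⊑ : ∀ {m n} → m ⊑ n → □R-ok L n → □R-ok L m
  □R-ok-⊑ zero ok = ok
  □R-ok-⊑ (suc {zero} _) _ = tt
  □R-ok-⊑ (suc {suc _} (s≤s _)) ok = ok

  ◇R-ok-⊑ : ∀ {m n} → m ⊑ n → ◇R-ok L n → ◇R-ok L m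
  ◇R-ok-⊑ zero ok = ok
  ◇R-ok-⊑ (suc _) ok = ok

  ◇Rᴰ-ok-⊑ : ∀ {m n} → m ⊑ n → ◇Rᴰ-ok L n → ◇Rᴰ-ok L m
  ◇Rᴰ-ok-⊑ zero ok = ok
  ◇Rᴰ-ok-⊑ (suc {zero} {n} _) ok = ◇Rᴰ-ok⁺⇒D n ok
  ◇Rᴰ-ok-⊑ (suc {suc _} (s≤s _)) ok = ok

  □L-ok-⊑ : ∀ {m n} → m ⊑ n → □L-ok L n → □L-ok L m
  □L-ok-⊑ zero ok = ok
  □L-ok-⊑ (suc m≤n) ok = □L-ok-anti⁺ m≤n ok

  -- Sizes in a principal cut on □X: n₀ boxes replace the copies of X among n, leaving m < n.
  □R-ok-merge : ∀ n₀ m {n} → m < n → □R-ok L n₀ → □R-ok L n → □R-ok L (n₀ + m)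
  □R-ok-merge zero zero _ ok₀ _ = ok₀
  □R-ok-merge zero (suc zero) _ _ _ = tt
  □R-ok-merge zero (suc (suc _)) (s≤s (s≤s (s≤s _))) _ c = c
  □R-ok-merge (suc zero) zero _ _ _ = tt
  □R-ok-merge (suc zero) (suc _) (s≤s (s≤s _)) _ c = c
  □R-ok-merge (suc (suc _)) _ _ c _ = c

  ◇R-ok-merge : ∀ n₀ m {n} → m < n → ◇R-ok L n → ◇R-ok L (n₀ + m)
  ◇R-ok-merge n₀ m (s≤s _) c = C⇒◇R-ok (n₀ + m) c

  ◇Rᴰ-ok-merge : ∀ n₀ m {n} → m < n → □R-ok L n₀ → ◇Rᴰ-ok L n → ◇Rᴰ-ok L (n₀ + m)
  ◇Rᴰ-ok-merge zero zero {suc n} _ N ok = inj₂ (◇Rᴰ-ok⁺⇒D n ok , N)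
  ◇Rᴰ-ok-merge zero (suc zero) (s≤s (s≤s _)) _ (d , _) = d
  ◇Rᴰ-ok-merge zero (suc (suc _)) (s≤s (s≤s (s≤s _))) _ ok = ok
  ◇Rᴰ-ok-merge (suc zero) zero {suc n} _ _ ok = ◇Rᴰ-ok⁺⇒D n ok
  ◇Rᴰ-ok-merge (suc zero) (suc _) (s≤s (s≤s _)) _ ok = ok
  ◇Rᴰ-ok-merge (suc (suc _)) _ {suc n} _ c ok = ◇Rᴰ-ok⁺⇒D n ok , c

  □L-ok-merge : ∀ n₀ m {n} → m < n → □R-ok L n₀ → □L-ok L n → □L-ok L (n₀ + m)
  □L-ok-merge zero zero _ _ _ = tt
  □L-ok-merge zero (suc m) {suc n} (s≤s m<n) _ ok = □L-ok-anti⁺ (<⇒≤ m<n) ok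
  □L-ok-merge (suc zero) zero {suc n} _ _ ok = □L-ok-anti⁺ {n = n} z≤n ok
  □L-ok-merge (suc zero) (suc m) {suc n} (s≤s m<n) _ ok = □L-ok-anti⁺ m<n ok
  □L-ok-merge (suc (suc n₀)) m {suc n} _ c ok =
    D∧C⇒□L-ok (n₀ + m) (□L-ok₁∧C⇒D (□L-ok-anti⁺ {n = n} z≤n ok) c) c

  ◇R-ok-+ : ∀ n₀ n → ◇R-ok L n₀ → ◇R-ok L n → ◇R-ok L (n₀ + n)
  ◇R-ok-+ zero n _ ok = ok
  ◇R-ok-+ (suc n₀) n c _ = c

  ◇Rᴰ-ok-+ : ∀ n₀ n → ◇Rᴰ-ok L n₀ → ◇R-ok L n → ◇Rᴰ-ok L (n₀ + n)
  ◇Rᴰ-ok-+ zero zero ok _ = ok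
  ◇Rᴰ-ok-+ zero (suc zero) ok c = ◇Rᴰ-ok₀∧C⇒D ok c
  ◇Rᴰ-ok-+ zero (suc (suc _)) ok c = ◇Rᴰ-ok₀∧C⇒D ok c , c
  ◇Rᴰ-ok-+ (suc zero) zero d _ = d
  ◇Rᴰ-ok-+ (suc zero) (suc _) d c = d , c
  ◇Rᴰ-ok-+ (suc (suc _)) _ ok _ = ok

  □R-ok-+ : ∀ n₀ n → ◇R-ok L n₀ → □R-ok L n → □R-ok L (n₀ + n)
  □R-ok-+ zero n _ ok = ok
  □R-ok-+ (suc n₀) n c _ = C⇒□R-ok⁺ (n₀ + n) c

  □L-ok-+ : ∀ n₀ n → ◇Rᴰ-ok L n₀ → □R-ok L n → □L-ok L (n₀ + n)
  □L-ok-+ zero zero _ _ = tt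
  □L-ok-+ zero (suc zero) (inj₁ p) _ = inj₁ p
  □L-ok-+ zero (suc zero) (inj₂ (d , _)) _ = inj₂ d
  □L-ok-+ zero (suc (suc zero)) ok c = ◇Rᴰ-ok₀∧C⇒D ok c
  □L-ok-+ zero (suc (suc (suc _))) ok c = ◇Rᴰ-ok₀∧C⇒D ok c , c
  □L-ok-+ (suc zero) zero d _ = inj₂ d
  □L-ok-+ (suc zero) (suc zero) d _ = d
  □L-ok-+ (suc zero) (suc (suc _)) d c = d , c
  □L-ok-+ (suc (suc n₀)) n (d , c) _ = D∧C⇒□L-ok (n₀ + n) d c

infix 4 _⊆□_
_⊆□_ : List Form → List Form → Set
Σ ⊆□ Γ = ∀ {A} → A ∈ Σ → □ A ∈ Γ

-- The sequent calculus

-- Contexts are lists read as sets: weakening along ⊆ also gives exchange and contraction.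
module Calculus (L : WLogic) where

  open SideConditions L

  infix 3 _⊩_
  data _⊩_ : List Form → Form → Set where
    ax  : ∀ {Γ A} → A ∈ Γ → Γ ⊩ A
    ⊥L  : ∀ {Γ C} → ⊥′ ∈ Γ → Γ ⊩ C
    ∧R  : ∀ {Γ A B} → Γ ⊩ A → Γ ⊩ B → Γ ⊩ A ∧′ B
    ∧L  : ∀ {Γ A B C} → A ∧′ B ∈ Γ → A ∷ B ∷ Γ ⊩ C → Γ ⊩ C
    ∨R₁ : ∀ {Γ A B} → Γ ⊩ A → Γ ⊩ A ∨′ B
    ∨R₂ : ∀ {Γ A B} → Γ ⊩ B → Γ ⊩ A ∨′ B
    ∨L  : ∀ {Γ A B C} → A ∨′ B ∈ Γ → A ∷ Γ ⊩ C → B ∷ Γ ⊩ C → Γ ⊩ C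
    ⇒R  : ∀ {Γ A B} → A ∷ Γ ⊩ B → Γ ⊩ A ⇒ B
    ⇒L  : ∀ {Γ A B C} → A ⇒ B ∈ Γ → Γ ⊩ A → B ∷ Γ ⊩ C → Γ ⊩ C
    T□L : ∀ {Γ A C} → T (hasT L) → □ A ∈ Γ → A ∷ Γ ⊩ C → Γ ⊩ C
    T◇R : ∀ {Γ A} → T (hasT L) → Γ ⊩ A → Γ ⊩ ◇ A
    □R  : ∀ {Γ B} Σ → Σ ⊆□ Γ → □R-ok L (length Σ) → Σ ⊩ B → Γ ⊩ □ B
    ◇R  : ∀ {Γ A B} Σ → Σ ⊆□ Γ → ◇ A ∈ Γ → ◇R-ok L (length Σ) → A ∷ Σ ⊩ B → Γ ⊩ ◇ B
    ◇Rᴰ : ∀ {Γ B} Σ → Σ ⊆□ Γ → ◇Rᴰ-ok L (length Σ) → Σ ⊩ B → Γ ⊩ ◇ B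
    ◇L  : ∀ {Γ A C} Σ → Σ ⊆□ Γ → ◇ A ∈ Γ → □R-ok L (length Σ) → A ∷ Σ ⊩ ⊥′ → Γ ⊩ C
    □L  : ∀ {Γ C} Σ → Σ ⊆□ Γ → □L-ok L (length Σ) → Σ ⊩ ⊥′ → Γ ⊩ C

  weaken : ∀ {Γ Δ C} → Γ ⊆ Δ → Γ ⊩ C → Δ ⊩ C
  weaken Γ⊆Δ (ax A∈) = ax (Γ⊆Δ A∈)
  weaken Γ⊆Δ (⊥L ⊥∈) = ⊥L (Γ⊆Δ ⊥∈)
  weaken Γ⊆Δ (∧R d e) = ∧R (weaken Γ⊆Δ d) (weaken Γ⊆Δ e)
  weaken Γ⊆Δ (∧L p d) = ∧L (Γ⊆Δ p) (weaken (∷⁺ʳ _ (∷⁺ʳ _ Γ⊆Δ)) d)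
  weaken Γ⊆Δ (∨R₁ d) = ∨R₁ (weaken Γ⊆Δ d)
  weaken Γ⊆Δ (∨R₂ d) = ∨R₂ (weaken Γ⊆Δ d)
  weaken Γ⊆Δ (∨L p d e) = ∨L (Γ⊆Δ p) (weaken (∷⁺ʳ _ Γ⊆Δ) d) (weaken (∷⁺ʳ _ Γ⊆Δ) e)
  weaken Γ⊆Δ (⇒R d) = ⇒R (weaken (∷⁺ʳ _ Γ⊆Δ) d)
  weaken Γ⊆Δ (⇒L p d e) = ⇒L (Γ⊆Δ p) (weaken Γ⊆Δ d) (weaken (∷⁺ʳ _ Γ⊆Δ) e)
  weaken Γ⊆Δ (T□L t p d) = T□L t (Γ⊆Δ p) (weaken (∷⁺ʳ _ Γ⊆Δ) d)
  weaken Γ⊆Δ (T◇R t d) = T◇R t (weaken Γ⊆Δ d)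
  weaken Γ⊆Δ (□R Σ Σ⊆ ok d) = □R Σ (Γ⊆Δ ∘ Σ⊆) ok d
  weaken Γ⊆Δ (◇R Σ Σ⊆ p ok d) = ◇R Σ (Γ⊆Δ ∘ Σ⊆) (Γ⊆Δ p) ok d
  weaken Γ⊆Δ (◇Rᴰ Σ Σ⊆ ok d) = ◇Rᴰ Σ (Γ⊆Δ ∘ Σ⊆) ok d
  weaken Γ⊆Δ (◇L Σ Σ⊆ p ok d) = ◇L Σ (Γ⊆Δ ∘ Σ⊆) (Γ⊆Δ p) ok d
  weaken Γ⊆Δ (□L Σ Σ⊆ ok d) = □L Σ (Γ⊆Δ ∘ Σ⊆) ok d

  ex-falso : ∀ {Γ C} → Γ ⊩ ⊥′ → Γ ⊩ C
  ex-falso (ax ⊥∈) = ⊥L ⊥∈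
  ex-falso (⊥L ⊥∈) = ⊥L ⊥∈
  ex-falso (∧L p d) = ∧L p (ex-falso d)
  ex-falso (∨L p d e) = ∨L p (ex-falso d) (ex-falso e)
  ex-falso (⇒L p d e) = ⇒L p d (ex-falso e)
  ex-falso (T□L t p d) = T□L t p (ex-falso d)
  ex-falso (◇L Σ Σ⊆ p ok d) = ◇L Σ Σ⊆ p ok d
  ex-falso (□L Σ Σ⊆ ok d) = □L Σ Σ⊆ ok d

  unbox-T : ∀ {Δ C} → T (hasT L) → ∀ Σ → Σ ⊆□ Δ → Σ ++ Δ ⊩ C → Δ ⊩ C
  unbox-T t [] Σ⊆ d = d
  unbox-T t (A ∷ Σ) Σ⊆ d = unbox-T t Σ (Σ⊆ ∘ there) (T□L t (∈-++⁺ʳ Σ (Σ⊆ (here refl))) d)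

  -- Cut admissibility

  Cut : Form → Set
  Cut A = ∀ {Γ C} → Γ ⊩ A → A ∷ Γ ⊩ C → Γ ⊩ C

  CutBelow : Form → Set
  CutBelow A = ∀ {B} → B ≺ A → Cut B

  data RightIntro (Γ : List Form) : Form → Set where
    ∧R  : ∀ {A B} → Γ ⊩ A → Γ ⊩ B → RightIntro Γ (A ∧′ B)
    ∨R₁ : ∀ {A B} → Γ ⊩ A → RightIntro Γ (A ∨′ B)
    ∨R₂ : ∀ {A B} → Γ ⊩ B → RightIntro Γ (A ∨′ B)
    ⇒R  : ∀ {A B} → A ∷ Γ ⊩ B → RightIntro Γ (A ⇒ B)
    T◇R : ∀ {A} → T (hasT L) → Γ ⊩ A → RightIntro Γ (◇ A)
    □R  : ∀ {B} Σ → Σ ⊆□ Γ → □R-ok L (length Σ) → Σ ⊩ B → RightIntro Γ (□ B)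
    ◇R  : ∀ {A B} Σ → Σ ⊆□ Γ → ◇ A ∈ Γ → ◇R-ok L (length Σ) → A ∷ Σ ⊩ B → RightIntro Γ (◇ B)
    ◇Rᴰ : ∀ {B} Σ → Σ ⊆□ Γ → ◇Rᴰ-ok L (length Σ) → Σ ⊩ B → RightIntro Γ (◇ B)

  rightIntro : ∀ {Γ A} → RightIntro Γ A → Γ ⊩ A
  rightIntro (∧R d e) = ∧R d e
  rightIntro (∨R₁ d) = ∨R₁ d
  rightIntro (∨R₂ d) = ∨R₂ d
  rightIntro (⇒R d) = ⇒R d
  rightIntro (T◇R t d) = T◇R t d
  rightIntro (□R Σ Σ⊆ ok d) = □R Σ Σ⊆ ok d
  rightIntro (◇R Σ Σ⊆ p ok d) = ◇R Σ Σ⊆ p ok d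
  rightIntro (◇Rᴰ Σ Σ⊆ ok d) = ◇Rᴰ Σ Σ⊆ ok d

  weakenRightIntro : ∀ {Γ Δ A} → Γ ⊆ Δ → RightIntro Γ A → RightIntro Δ A
  weakenRightIntro Γ⊆Δ (∧R d e) = ∧R (weaken Γ⊆Δ d) (weaken Γ⊆Δ e)
  weakenRightIntro Γ⊆Δ (∨R₁ d) = ∨R₁ (weaken Γ⊆Δ d)
  weakenRightIntro Γ⊆Δ (∨R₂ d) = ∨R₂ (weaken Γ⊆Δ d)
  weakenRightIntro Γ⊆Δ (⇒R d) = ⇒R (weaken (∷⁺ʳ _ Γ⊆Δ) d)
  weakenRightIntro Γ⊆Δ (T◇R t d) = T◇R t (weaken Γ⊆Δ d)
  weakenRightIntro Γ⊆Δ (□R Σ Σ⊆ ok d) = □R Σ (Γ⊆Δ ∘ Σ⊆) ok d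
  weakenRightIntro Γ⊆Δ (◇R Σ Σ⊆ p ok d) = ◇R Σ (Γ⊆Δ ∘ Σ⊆) (Γ⊆Δ p) ok d
  weakenRightIntro Γ⊆Δ (◇Rᴰ Σ Σ⊆ ok d) = ◇Rᴰ Σ (Γ⊆Δ ∘ Σ⊆) ok d

  □-injective : ∀ {A B} → □ A ≡ □ B → A ≡ B
  □-injective refl = refl

  ⊆□-∷ : ∀ {A Γ} Σ → Σ ⊆□ A ∷ Γ → Σ ⊆□ Γ ⊎ ∃ λ X → A ≡ □ X × X ∈ Σ
  ⊆□-∷ {A} Σ Σ⊆ with any? (λ X → □ X ≟ A) Σ
  ... | yes hit = let (X , X∈ , □X≡A) = find hit in inj₂ (X , sym □X≡A , X∈)
  ... | no miss = inj₁ Σ⊆Γ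
    where
    Σ⊆Γ : Σ ⊆□ _
    Σ⊆Γ B∈ with Σ⊆ B∈
    ... | here □B≡A = ⊥-elim (miss (lose B∈ □B≡A))
    ... | there □B∈Γ = □B∈Γ

  ⊆□-∷◇ : ∀ {A Γ} Σ → Σ ⊆□ ◇ A ∷ Γ → Σ ⊆□ Γ
  ⊆□-∷◇ Σ Σ⊆ B∈ with Σ⊆ B∈
  ... | there □B∈Γ = □B∈Γ

  -- In a principal cut on □X, the boxes Σ₀ from which □X was derived replace X in Σ.
  ⊆□-merge : ∀ {X Γ Σ₀} Σ → Σ₀ ⊆□ Γ → Σ ⊆□ □ X ∷ Γ → Σ₀ ++ Σ ∖ X ⊆□ Γ
  ⊆□-merge {Σ₀ = Σ₀} Σ Σ₀⊆ Σ⊆ A∈ with ∈-++⁻ Σ₀ A∈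
  ... | inj₁ A∈Σ₀ = Σ₀⊆ A∈Σ₀
  ... | inj₂ A∈Σ∖X with ∈-∖⁻ Σ A∈Σ∖X
  ...   | A∈Σ , A≢X with Σ⊆ A∈Σ
  ...     | here □A≡□X = ⊥-elim (A≢X (□-injective □A≡□X))
  ...     | there □A∈Γ = □A∈Γ

  ⊆□-++ : ∀ {Γ} Σ₀ {Σ} → Σ₀ ⊆□ Γ → Σ ⊆□ Γ → Σ₀ ++ Σ ⊆□ Γ
  ⊆□-++ Σ₀ Σ₀⊆ Σ⊆ A∈ with ∈-++⁻ Σ₀ A∈
  ... | inj₁ A∈Σ₀ = Σ₀⊆ A∈Σ₀
  ... | inj₂ A∈Σ = Σ⊆ A∈Σ

  cut-merge : ∀ {X Σ₀ B} Π Σ → Cut X → Σ₀ ⊩ X → Π ++ Σ ⊩ B → Π ++ (Σ₀ ++ Σ ∖ X) ⊩ B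
  cut-merge {X} {Σ₀} Π Σ cut d₀ d = cut (weaken (∈-++⁺ʳ Π ∘ ∈-++⁺ˡ) d₀) (weaken Π++Σ⊆ d)
    where
    Π++Σ⊆ : Π ++ Σ ⊆ X ∷ Π ++ (Σ₀ ++ Σ ∖ X)
    Π++Σ⊆ {A} A∈ with ∈-++⁻ Π A∈
    ... | inj₁ A∈Π = there (∈-++⁺ˡ A∈Π)
    ... | inj₂ A∈Σ with A ≟ X
    ...   | yes refl = here refl
    ...   | no A≢X = there (∈-++⁺ʳ Π (∈-++⁺ʳ Σ₀ (∈-∖⁺ A∈Σ A≢X)))

  length-++-subst : ∀ (P : ℕ → Set) xs {ys : List Form} →
                    P (length xs + length ys) → P (length (xs ++ ys))
  length-++-subst P xs p = subst P (sym (length-++ xs)) p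

  principal∧ : ∀ {A B Γ C} → CutBelow (A ∧′ B) → RightIntro Γ (A ∧′ B) → A ∷ B ∷ Γ ⊩ C → Γ ⊩ C
  principal∧ cut< (∧R d₁ d₂) e = cut< ∧₁ d₁ (cut< ∧₂ (weaken there d₂) (weaken swap e))
    where
    swap : ∀ {A B Γ} → A ∷ B ∷ Γ ⊆ B ∷ A ∷ Γ
    swap (here refl) = there (here refl)
    swap (there (here refl)) = here refl
    swap (there (there p)) = there (there p)

  principal∨ : ∀ {A B Γ C} → CutBelow (A ∨′ B) → RightIntro Γ (A ∨′ B) → A ∷ Γ ⊩ C → B ∷ Γ ⊩ C → Γ ⊩ C
  principal∨ cut< (∨R₁ d) e₁ e₂ = cut< ∨₁ d e₁
  principal∨ cut< (∨R₂ d) e₁ e₂ = cut< ∨₂ d e₂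

  principal⇒ : ∀ {A B Γ C} → CutBelow (A ⇒ B) → RightIntro Γ (A ⇒ B) → Γ ⊩ A → B ∷ Γ ⊩ C → Γ ⊩ C
  principal⇒ cut< (⇒R d) a e = cut< ⇒₂ (cut< ⇒₁ a d) e

  principalT□ : ∀ {X Γ C} → T (hasT L) → Cut X → RightIntro Γ (□ X) → X ∷ Γ ⊩ C → Γ ⊩ C
  principalT□ {Γ = Γ} t cut (□R Σ₀ Σ₀⊆ _ d₀) e = cut (unbox-T t Σ₀ Σ₀⊆ (weaken ∈-++⁺ˡ d₀)) e

  principal□-□R : ∀ {X Γ Σ B} → Cut X → RightIntro Γ (□ X) → X ∈ Σ → Σ ⊆□ □ X ∷ Γ →
                  □R-ok L (length Σ) → Σ ⊩ B → Γ ⊩ □ B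
  principal□-□R {Σ = Σ} cut (□R Σ₀ Σ₀⊆ ok₀ d₀) X∈ Σ⊆ ok d =
    □R (Σ₀ ++ Σ ∖ _) (⊆□-merge Σ Σ₀⊆ Σ⊆)
       (length-++-subst (□R-ok L) Σ₀ (□R-ok-merge (length Σ₀) _ (length-∖-< Σ X∈) ok₀ ok))
       (cut-merge [] Σ cut d₀ d)

  principal□-◇R : ∀ {X Γ Σ A B} → Cut X → RightIntro Γ (□ X) → X ∈ Σ → Σ ⊆□ □ X ∷ Γ → ◇ A ∈ Γ →
                  ◇R-ok L (length Σ) → A ∷ Σ ⊩ B → Γ ⊩ ◇ B
  principal□-◇R {Σ = Σ} {A} cut (□R Σ₀ Σ₀⊆ _ d₀) X∈ Σ⊆ ◇A∈ ok d =
    ◇R (Σ₀ ++ Σ ∖ _) (⊆□-merge Σ Σ₀⊆ Σ⊆) ◇A∈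
       (length-++-subst (◇R-ok L) Σ₀ (◇R-ok-merge (length Σ₀) _ (length-∖-< Σ X∈) ok))
       (cut-merge (A ∷ []) Σ cut d₀ d)

  principal□-◇Rᴰ : ∀ {X Γ Σ B} → Cut X → RightIntro Γ (□ X) → X ∈ Σ → Σ ⊆□ □ X ∷ Γ →
                   ◇Rᴰ-ok L (length Σ) → Σ ⊩ B → Γ ⊩ ◇ B
  principal□-◇Rᴰ {Σ = Σ} cut (□R Σ₀ Σ₀⊆ ok₀ d₀) X∈ Σ⊆ ok d =
    ◇Rᴰ (Σ₀ ++ Σ ∖ _) (⊆□-merge Σ Σ₀⊆ Σ⊆)
        (length-++-subst (◇Rᴰ-ok L) Σ₀ (◇Rᴰ-ok-merge (length Σ₀) _ (length-∖-< Σ X∈) ok₀ ok))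
        (cut-merge [] Σ cut d₀ d)

  principal□-◇L : ∀ {X Γ Σ A C} → Cut X → RightIntro Γ (□ X) → X ∈ Σ → Σ ⊆□ □ X ∷ Γ → ◇ A ∈ Γ →
                  □R-ok L (length Σ) → A ∷ Σ ⊩ ⊥′ → Γ ⊩ C
  principal□-◇L {Σ = Σ} {A} cut (□R Σ₀ Σ₀⊆ ok₀ d₀) X∈ Σ⊆ ◇A∈ ok d =
    ◇L (Σ₀ ++ Σ ∖ _) (⊆□-merge Σ Σ₀⊆ Σ⊆) ◇A∈
       (length-++-subst (□R-ok L) Σ₀ (□R-ok-merge (length Σ₀) _ (length-∖-< Σ X∈) ok₀ ok))
       (cut-merge (A ∷ []) Σ cut d₀ d)

  principal□-□L : ∀ {X Γ Σ C} → Cut X → RightIntro Γ (□ X) → X ∈ Σ → Σ ⊆□ □ X ∷ Γ →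
                  □L-ok L (length Σ) → Σ ⊩ ⊥′ → Γ ⊩ C
  principal□-□L {Σ = Σ} cut (□R Σ₀ Σ₀⊆ ok₀ d₀) X∈ Σ⊆ ok d =
    □L (Σ₀ ++ Σ ∖ _) (⊆□-merge Σ Σ₀⊆ Σ⊆)
       (length-++-subst (□L-ok L) Σ₀ (□L-ok-merge (length Σ₀) _ (length-∖-< Σ X∈) ok₀ ok))
       (cut-merge [] Σ cut d₀ d)

  principal◇-◇R : ∀ {A Γ Σ B} → Cut A → RightIntro Γ (◇ A) → Σ ⊆□ Γ →
                  ◇R-ok L (length Σ) → A ∷ Σ ⊩ B → Γ ⊩ ◇ B
  principal◇-◇R {Σ = Σ} cut (◇R Σ₀ Σ₀⊆ ◇E∈ ok₀ d₀) Σ⊆ ok d =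
    ◇R (Σ₀ ++ Σ) (⊆□-++ Σ₀ Σ₀⊆ Σ⊆) ◇E∈
       (length-++-subst (◇R-ok L) Σ₀ (◇R-ok-+ (length Σ₀) (length Σ) ok₀ ok))
       (cut (weaken (∷⁺ʳ _ ∈-++⁺ˡ) d₀) (weaken (∷⁺ʳ _ (there ∘ ∈-++⁺ʳ Σ₀)) d))
  principal◇-◇R {Σ = Σ} cut (◇Rᴰ Σ₀ Σ₀⊆ ok₀ d₀) Σ⊆ ok d =
    ◇Rᴰ (Σ₀ ++ Σ) (⊆□-++ Σ₀ Σ₀⊆ Σ⊆)
       (length-++-subst (◇Rᴰ-ok L) Σ₀ (◇Rᴰ-ok-+ (length Σ₀) (length Σ) ok₀ ok))
        (cut (weaken ∈-++⁺ˡ d₀) (weaken (∷⁺ʳ _ (∈-++⁺ʳ Σ₀)) d))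
  principal◇-◇R {Σ = Σ} cut (T◇R t d₀) Σ⊆ ok d =
    T◇R t (cut d₀ (unbox-T t Σ (there ∘ Σ⊆) (weaken (∈-∷⁺ʳ (∈-++⁺ʳ Σ (here refl)) ∈-++⁺ˡ) d)))

  principal◇-◇L : ∀ {A Γ Σ C} → Cut A → RightIntro Γ (◇ A) → Σ ⊆□ Γ →
                  □R-ok L (length Σ) → A ∷ Σ ⊩ ⊥′ → Γ ⊩ C
  principal◇-◇L {Σ = Σ} cut (◇R Σ₀ Σ₀⊆ ◇E∈ ok₀ d₀) Σ⊆ ok d =
    ◇L (Σ₀ ++ Σ) (⊆□-++ Σ₀ Σ₀⊆ Σ⊆) ◇E∈
       (length-++-subst (□R-ok L) Σ₀ (□R-ok-+ (length Σ₀) (length Σ) ok₀ ok))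
       (cut (weaken (∷⁺ʳ _ ∈-++⁺ˡ) d₀) (weaken (∷⁺ʳ _ (there ∘ ∈-++⁺ʳ Σ₀)) d))
  principal◇-◇L {Σ = Σ} cut (◇Rᴰ Σ₀ Σ₀⊆ ok₀ d₀) Σ⊆ ok d =
    □L (Σ₀ ++ Σ) (⊆□-++ Σ₀ Σ₀⊆ Σ⊆) (length-++-subst (□L-ok L) Σ₀ (□L-ok-+ (length Σ₀) (length Σ) ok₀ ok))
       (cut (weaken ∈-++⁺ˡ d₀) (weaken (∷⁺ʳ _ (∈-++⁺ʳ Σ₀)) d))
  principal◇-◇L {Σ = Σ} cut (T◇R t d₀) Σ⊆ ok d =
    ex-falso (cut d₀ (unbox-T t Σ (there ∘ Σ⊆) (weaken (∈-∷⁺ʳ (∈-++⁺ʳ Σ (here refl)) ∈-++⁺ˡ) d)))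

  cut-□R : ∀ {A Γ B} → CutBelow A → RightIntro Γ A → ∀ Σ → Σ ⊆□ A ∷ Γ →
           □R-ok L (length Σ) → Σ ⊩ B → Γ ⊩ □ B
  cut-□R cut< r Σ Σ⊆ ok d with ⊆□-∷ Σ Σ⊆
  ... | inj₁ Σ⊆Γ = □R Σ Σ⊆Γ ok d
  ... | inj₂ (X , refl , X∈) = principal□-□R (cut< □₁) r X∈ Σ⊆ ok d

  cut-◇R : ∀ {A Γ E B} → CutBelow A → RightIntro Γ A → ∀ Σ → Σ ⊆□ A ∷ Γ → ◇ E ∈ A ∷ Γ →
           ◇R-ok L (length Σ) → E ∷ Σ ⊩ B → Γ ⊩ ◇ B
  cut-◇R cut< r Σ Σ⊆ (here refl) ok d = principal◇-◇R (cut< ◇₁) r (⊆□-∷◇ Σ Σ⊆) ok d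
  cut-◇R cut< r Σ Σ⊆ (there p) ok d with ⊆□-∷ Σ Σ⊆
  ... | inj₁ Σ⊆Γ = ◇R Σ Σ⊆Γ p ok d
  ... | inj₂ (X , refl , X∈) = principal□-◇R (cut< □₁) r X∈ Σ⊆ p ok d

  cut-◇Rᴰ : ∀ {A Γ B} → CutBelow A → RightIntro Γ A → ∀ Σ → Σ ⊆□ A ∷ Γ →
            ◇Rᴰ-ok L (length Σ) → Σ ⊩ B → Γ ⊩ ◇ B
  cut-◇Rᴰ cut< r Σ Σ⊆ ok d with ⊆□-∷ Σ Σ⊆
  ... | inj₁ Σ⊆Γ = ◇Rᴰ Σ Σ⊆Γ ok d
  ... | inj₂ (X , refl , X∈) = principal□-◇Rᴰ (cut< □₁) r X∈ Σ⊆ ok d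

  cut-◇L : ∀ {A Γ E C} → CutBelow A → RightIntro Γ A → ∀ Σ → Σ ⊆□ A ∷ Γ → ◇ E ∈ A ∷ Γ →
           □R-ok L (length Σ) → E ∷ Σ ⊩ ⊥′ → Γ ⊩ C
  cut-◇L cut< r Σ Σ⊆ (here refl) ok d = principal◇-◇L (cut< ◇₁) r (⊆□-∷◇ Σ Σ⊆) ok d
  cut-◇L cut< r Σ Σ⊆ (there p) ok d with ⊆□-∷ Σ Σ⊆
  ... | inj₁ Σ⊆Γ = ◇L Σ Σ⊆Γ p ok d
  ... | inj₂ (X , refl , X∈) = principal□-◇L (cut< □₁) r X∈ Σ⊆ p ok d

  cut-□L : ∀ {A Γ C} → CutBelow A → RightIntro Γ A → ∀ Σ → Σ ⊆□ A ∷ Γ →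
           □L-ok L (length Σ) → Σ ⊩ ⊥′ → Γ ⊩ C
  cut-□L cut< r Σ Σ⊆ ok d with ⊆□-∷ Σ Σ⊆
  ... | inj₁ Σ⊆Γ = □L Σ Σ⊆Γ ok d
  ... | inj₂ (X , refl , X∈) = principal□-□L (cut< □₁) r X∈ Σ⊆ ok d

  push : ∀ {A B : Form} {Γ Δ} → Δ ⊆ A ∷ Γ → B ∷ Δ ⊆ A ∷ B ∷ Γ
  push Δ⊆ (here refl) = there (here refl)
  push Δ⊆ (there p) with Δ⊆ p
  ... | here A≡ = here A≡
  ... | there q = there (there q)

  -- Induction on the right premise, whose context Δ may also be any weakening of A ∷ Γ.
  cut-rightIntro : ∀ {A Γ Δ C} → CutBelow A → RightIntro Γ A → Δ ⊆ A ∷ Γ → Δ ⊩ C → Γ ⊩ C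
  cut-rightIntro cut< r Δ⊆ (ax p) with Δ⊆ p
  ... | here refl = rightIntro r
  ... | there q = ax q
  cut-rightIntro cut< r Δ⊆ (⊥L p) with Δ⊆ p | r
  ... | here refl | ()
  ... | there q   | _ = ⊥L q
  cut-rightIntro cut< r Δ⊆ (∧R d e) = ∧R (cut-rightIntro cut< r Δ⊆ d) (cut-rightIntro cut< r Δ⊆ e)
  cut-rightIntro cut< r Δ⊆ (∧L p d)
    with Δ⊆ p | cut-rightIntro cut< (weakenRightIntro (there ∘ there) r) (push (push Δ⊆)) d
  ... | here refl | d′ = principal∧ cut< r d′
  ... | there q   | d′ = ∧L q d′
  cut-rightIntro cut< r Δ⊆ (∨R₁ d) = ∨R₁ (cut-rightIntro cut< r Δ⊆ d)
  cut-rightIntro cut< r Δ⊆ (∨R₂ d) = ∨R₂ (cut-rightIntro cut< r Δ⊆ d)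
  cut-rightIntro cut< r Δ⊆ (∨L p d e)
    with Δ⊆ p | cut-rightIntro cut< (weakenRightIntro there r) (push Δ⊆) d
              | cut-rightIntro cut< (weakenRightIntro there r) (push Δ⊆) e
  ... | here refl | d′ | e′ = principal∨ cut< r d′ e′
  ... | there q   | d′ | e′ = ∨L q d′ e′
  cut-rightIntro cut< r Δ⊆ (⇒R d) = ⇒R (cut-rightIntro cut< (weakenRightIntro there r) (push Δ⊆) d)
  cut-rightIntro cut< r Δ⊆ (⇒L p d e)
    with Δ⊆ p | cut-rightIntro cut< r Δ⊆ d | cut-rightIntro cut< (weakenRightIntro there r) (push Δ⊆) e
  ... | here refl | d′ | e′ = principal⇒ cut< r d′ e′
  ... | there q   | d′ | e′ = ⇒L q d′ e′
  cut-rightIntro cut< r Δ⊆ (T□L t p d)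
    with Δ⊆ p | cut-rightIntro cut< (weakenRightIntro there r) (push Δ⊆) d
  ... | here refl | d′ = principalT□ t (cut< □₁) r d′
  ... | there q   | d′ = T□L t q d′
  cut-rightIntro cut< r Δ⊆ (T◇R t d) = T◇R t (cut-rightIntro cut< r Δ⊆ d)
  cut-rightIntro cut< r Δ⊆ (□R Σ Σ⊆ ok d) = cut-□R cut< r Σ (Δ⊆ ∘ Σ⊆) ok d
  cut-rightIntro cut< r Δ⊆ (◇R Σ Σ⊆ p ok d) = cut-◇R cut< r Σ (Δ⊆ ∘ Σ⊆) (Δ⊆ p) ok d
  cut-rightIntro cut< r Δ⊆ (◇Rᴰ Σ Σ⊆ ok d) = cut-◇Rᴰ cut< r Σ (Δ⊆ ∘ Σ⊆) ok d
  cut-rightIntro cut< r Δ⊆ (◇L Σ Σ⊆ p ok d) = cut-◇L cut< r Σ (Δ⊆ ∘ Σ⊆) (Δ⊆ p) ok d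
  cut-rightIntro cut< r Δ⊆ (□L Σ Σ⊆ ok d) = cut-□L cut< r Σ (Δ⊆ ∘ Σ⊆) ok d

  -- Left rules of the left premise permute above the cut; once it ends in a right rule,
  -- the cut is pushed into the right premise.
  cut-left : ∀ {A Γ C} → CutBelow A → Γ ⊩ A → A ∷ Γ ⊩ C → Γ ⊩ C
  cut-left cut< (ax A∈) e = weaken (∈-∷⁺ʳ A∈ ⊆-refl) e
  cut-left cut< (⊥L ⊥∈) e = ⊥L ⊥∈
  cut-left cut< (∧L p d) e = ∧L p (cut-left cut< d (weaken (∷⁺ʳ _ (there ∘ there)) e))
  cut-left cut< (∨L p d₁ d₂) e =
    ∨L p (cut-left cut< d₁ (weaken (∷⁺ʳ _ there) e)) (cut-left cut< d₂ (weaken (∷⁺ʳ _ there) e))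
  cut-left cut< (⇒L p d₁ d₂) e = ⇒L p d₁ (cut-left cut< d₂ (weaken (∷⁺ʳ _ there) e))
  cut-left cut< (T□L t p d) e = T□L t p (cut-left cut< d (weaken (∷⁺ʳ _ there) e))
  cut-left cut< (◇L Σ Σ⊆ p ok d) e = ◇L Σ Σ⊆ p ok d
  cut-left cut< (□L Σ Σ⊆ ok d) e = □L Σ Σ⊆ ok d
  cut-left cut< (∧R d₁ d₂) e = cut-rightIntro cut< (∧R d₁ d₂) ⊆-refl e
  cut-left cut< (∨R₁ d) e = cut-rightIntro cut< (∨R₁ d) ⊆-refl e
  cut-left cut< (∨R₂ d) e = cut-rightIntro cut< (∨R₂ d) ⊆-refl e
  cut-left cut< (⇒R d) e = cut-rightIntro cut< (⇒R d) ⊆-refl e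
  cut-left cut< (T◇R t d) e = cut-rightIntro cut< (T◇R t d) ⊆-refl e
  cut-left cut< (□R Σ Σ⊆ ok d) e = cut-rightIntro cut< (□R Σ Σ⊆ ok d) ⊆-refl e
  cut-left cut< (◇R Σ Σ⊆ p ok d) e = cut-rightIntro cut< (◇R Σ Σ⊆ p ok d) ⊆-refl e
  cut-left cut< (◇Rᴰ Σ Σ⊆ ok d) e = cut-rightIntro cut< (◇Rᴰ Σ Σ⊆ ok d) ⊆-refl e

  cut : ∀ A → Cut A
  cut A = cut-left cut<
    where
    cut< : CutBelow A
    cut< {B} ∧₁ = cut B
    cut< {B} ∧₂ = cut B
    cut< {B} ∨₁ = cut B
    cut< {B} ∨₂ = cut B
    cut< {B} ⇒₁ = cut B
    cut< {B} ⇒₂ = cut B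
    cut< {B} □₁ = cut B
    cut< {B} ◇₁ = cut B

-- Equivalence with the Hilbert system

⋀ : List Form → Form
⋀ [] = ⊤′
⋀ (A ∷ Σ) = A ∧′ ⋀ Σ

module Hilbert (L : WLogic) where

  open SideConditions L

  infix 3 _⊢ₕ_
  data _⊢ₕ_ (Γ : List Form) : Form → Set where
    hyp : ∀ {A} → A ∈ Γ → Γ ⊢ₕ A
    thm : ∀ {A} → L ⊢ A → Γ ⊢ₕ A
    app : ∀ {A B} → Γ ⊢ₕ A ⇒ B → Γ ⊢ₕ A → Γ ⊢ₕ B

  ⊢-id : ∀ {A} → L ⊢ A ⇒ A
  ⊢-id {A} = mp (mp ax-S ax-K) (ax-K {B = A})

  _·_ : ∀ {Γ A B} → L ⊢ A ⇒ B → Γ ⊢ₕ A → Γ ⊢ₕ B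
  t · d = app (thm t) d

  deduction : ∀ {Γ A B} → A ∷ Γ ⊢ₕ B → Γ ⊢ₕ A ⇒ B
  deduction (hyp (here refl)) = thm ⊢-id
  deduction (hyp (there p)) = ax-K · hyp p
  deduction (thm t) = ax-K · thm t
  deduction (app d e) = app (ax-S · deduction d) (deduction e)

  closed : ∀ {A} → [] ⊢ₕ A → L ⊢ A
  closed (thm t) = t
  closed (app d e) = mp (closed d) (closed e)

  substitute : ∀ {Γ Δ B} → Γ ⊢ₕ B → (∀ {A} → A ∈ Γ → Δ ⊢ₕ A) → Δ ⊢ₕ B
  substitute (hyp p) σ = σ p
  substitute (thm t) σ = thm t
  substitute (app d e) σ = app (substitute d σ) (substitute e σ)

  cut-hyp : ∀ {Γ A C} → A ∷ Γ ⊢ₕ C → Γ ⊢ₕ A → Γ ⊢ₕ C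
  cut-hyp d a = app (deduction d) a

  pair : ∀ {Γ A B} → Γ ⊢ₕ A → Γ ⊢ₕ B → Γ ⊢ₕ A ∧′ B
  pair a b = app (ax-∧I · a) b

  trivial : ∀ {Γ} → Γ ⊢ₕ ⊤′
  trivial = thm ⊢-id

  ⋀-lookup : ∀ {Δ A} Σ → A ∈ Σ → Δ ⊢ₕ ⋀ Σ → Δ ⊢ₕ A
  ⋀-lookup (_ ∷ Σ) (here refl) d = ax-∧E₁ · d
  ⋀-lookup (_ ∷ Σ) (there p) d = ⋀-lookup Σ p (ax-∧E₂ · d)

  ⋀⇒ : ∀ {Σ B} → Σ ⊢ₕ B → L ⊢ ⋀ Σ ⇒ B
  ⋀⇒ {Σ} d = closed (deduction (substitute d (λ p → ⋀-lookup Σ p (hyp (here refl)))))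

  ⇒⋀⇒ : ∀ {A Σ B} → A ∷ Σ ⊢ₕ B → L ⊢ A ⇒ ⋀ Σ ⇒ B
  ⇒⋀⇒ {A} {Σ} d = closed (deduction (deduction (substitute d σ)))
    where
    σ : ∀ {C} → C ∈ A ∷ Σ → ⋀ Σ ∷ A ∷ [] ⊢ₕ C
    σ (here refl) = hyp (there (here refl))
    σ (there p) = ⋀-lookup Σ p (hyp (here refl))

  ⇒-swap : ∀ {A B C} → L ⊢ A ⇒ B ⇒ C → L ⊢ B ⇒ A ⇒ C
  ⇒-swap t = closed (deduction (deduction (app (t · hyp (here refl)) (hyp (there (here refl))))))

  □⋀ : ∀ {Γ} Σ → Σ ⊆□ Γ → □R-ok L (length Σ) → Γ ⊢ₕ □ (⋀ Σ)
  □⋀ [] _ n = thm (N□ n)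
  □⋀ (A ∷ []) Σ⊆ _ = mon□ (closed (deduction (pair (hyp (here refl)) trivial))) · hyp (Σ⊆ (here refl))
  □⋀ (A ∷ B ∷ Σ) Σ⊆ c =
    C□ c · pair (hyp (Σ⊆ (here refl))) (□⋀ (B ∷ Σ) (Σ⊆ ∘ there) (C⇒□R-ok⁺ (length Σ) c))

  ◇⋀ : ∀ {Γ} Σ → Σ ⊆□ Γ → ◇Rᴰ-ok L (length Σ) → Γ ⊢ₕ ◇ (⋀ Σ)
  ◇⋀ [] _ (inj₁ p) = thm (P◇ p)
  ◇⋀ [] _ (inj₂ (d , n)) = D d · thm (N□ n)
  ◇⋀ (A ∷ []) Σ⊆ d = D d · □⋀ (A ∷ []) Σ⊆ tt
  ◇⋀ (A ∷ B ∷ Σ) Σ⊆ (d , c) = D d · □⋀ (A ∷ B ∷ Σ) Σ⊆ c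

  dual-⊥ : ∀ {Γ X Y} → Γ ⊢ₕ □ X → Γ ⊢ₕ ◇ Y → L ⊢ Y ⇒ X ⇒ ⊥′ → Γ ⊢ₕ ⊥′
  dual-⊥ □X ◇Y Y⇒¬X = dual∧ · pair □X (mon◇ Y⇒¬X · ◇Y)

module Equivalence (L : WLogic) where

  open SideConditions L
  open Calculus L
  open Hilbert L

  -- Two boxes □A, □B need no C: D turns □A into ◇A, which the dual axiom confronts with □B.
  □L-sound : ∀ {Γ} Σ → Σ ⊆□ Γ → □L-ok L (length Σ) → L ⊢ ⋀ Σ ⇒ ⊥′ → Γ ⊢ₕ ⊥′
  □L-sound [] _ _ ¬⋀Σ = ¬⋀Σ · trivial
  □L-sound (A ∷ []) Σ⊆ (inj₁ p) ¬⋀Σ = dual-⊥ (□⋀ (A ∷ []) Σ⊆ tt) (thm (P◇ p)) (mp ax-K ¬⋀Σ)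
  □L-sound (A ∷ []) Σ⊆ (inj₂ d) ¬⋀Σ = dual-⊥ (□⋀ (A ∷ []) Σ⊆ tt) (D d · □⋀ (A ∷ []) Σ⊆ tt) (mp ax-K ¬⋀Σ)
  □L-sound (A ∷ B ∷ []) Σ⊆ d ¬⋀Σ =
    dual-⊥ (□⋀ (B ∷ []) (Σ⊆ ∘ there) tt) (D d · hyp (Σ⊆ (here refl)))
           (closed (deduction (deduction (¬⋀Σ · pair (hyp (there (here refl))) (hyp (here refl))))))
  □L-sound Σ@(_ ∷ _ ∷ _ ∷ _) Σ⊆ (d , c) ¬⋀Σ = dual-⊥ (□⋀ Σ Σ⊆ c) (D d · □⋀ Σ Σ⊆ c) (mp ax-K ¬⋀Σ)

  sound : ∀ {Γ C} → Γ ⊩ C → Γ ⊢ₕ C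
  sound (ax p) = hyp p
  sound (⊥L p) = ax-⊥E · hyp p
  sound (∧R d e) = pair (sound d) (sound e)
  sound (∧L p d) = cut-hyp (cut-hyp (sound d) (ax-∧E₁ · hyp (there p))) (ax-∧E₂ · hyp p)
  sound (∨R₁ d) = ax-∨I₁ · sound d
  sound (∨R₂ d) = ax-∨I₂ · sound d
  sound (∨L p d e) = app (app (ax-∨E · deduction (sound d)) (deduction (sound e))) (hyp p)
  sound (⇒R d) = deduction (sound d)
  sound (⇒L p d e) = cut-hyp (sound e) (app (hyp p) (sound d))
  sound (T□L t p d) = cut-hyp (sound d) (T□ t · hyp p)
  sound (T◇R t d) = T◇ t · sound d
  sound (□R Σ Σ⊆ ok d) = mon□ (⋀⇒ (sound d)) · □⋀ Σ Σ⊆ ok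
  sound (◇R [] _ p _ d) =
    mon◇ (closed (deduction (app (⇒⋀⇒ (sound d) · hyp (here refl)) trivial))) · hyp p
  sound (◇R Σ@(_ ∷ Σ′) Σ⊆ p c d) =
    app (K◇ c · (mon□ (⇒-swap (⇒⋀⇒ (sound d))) · □⋀ Σ Σ⊆ (C⇒□R-ok⁺ (length Σ′) c))) (hyp p)
  sound (◇Rᴰ Σ Σ⊆ ok d) = mon◇ (⋀⇒ (sound d)) · ◇⋀ Σ Σ⊆ ok
  sound (◇L Σ Σ⊆ p ok d) = ax-⊥E · dual-⊥ (□⋀ Σ Σ⊆ ok) (hyp p) (⇒⋀⇒ (sound d))
  sound (□L Σ Σ⊆ ok d) = ax-⊥E · □L-sound Σ Σ⊆ ok (⋀⇒ (sound d))

  private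
    h₀ : ∀ {A : Form} {Γ} → A ∈ A ∷ Γ
    h₀ = here refl
    h₁ : ∀ {A B : Form} {Γ} → A ∈ B ∷ A ∷ Γ
    h₁ = there h₀
    h₂ : ∀ {A B C : Form} {Γ} → A ∈ C ∷ B ∷ A ∷ Γ
    h₂ = there h₁
    h₃ : ∀ {A B C E : Form} {Γ} → A ∈ E ∷ C ∷ B ∷ A ∷ Γ
    h₃ = there h₂

  ⇒-inversion : ∀ {Γ A B} → Γ ⊩ A ⇒ B → A ∷ Γ ⊩ B
  ⇒-inversion {A = A} {B} d = cut (A ⇒ B) (weaken there d) (⇒L h₀ (ax h₁) (ax h₀))

  ⊩→⊢ : ∀ {A} → [] ⊩ A → L ⊢ A
  ⊩→⊢ = closed ∘ sound

  ⊢→⊩ : ∀ {A} → L ⊢ A → [] ⊩ A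
  ⊢→⊩ ax-K = ⇒R (⇒R (ax h₁))
  ⊢→⊩ ax-S = ⇒R (⇒R (⇒R (⇒L h₂ (ax h₀) (⇒L h₂ (ax h₁) (⇒L h₁ (ax h₀) (ax h₀))))))
  ⊢→⊩ ax-∧E₁ = ⇒R (∧L h₀ (ax h₀))
  ⊢→⊩ ax-∧E₂ = ⇒R (∧L h₀ (ax h₁))
  ⊢→⊩ ax-∧I = ⇒R (⇒R (∧R (ax h₁) (ax h₀)))
  ⊢→⊩ ax-∨I₁ = ⇒R (∨R₁ (ax h₀))
  ⊢→⊩ ax-∨I₂ = ⇒R (∨R₂ (ax h₀))
  ⊢→⊩ ax-∨E = ⇒R (⇒R (⇒R (∨L h₀ (⇒L h₃ (ax h₀) (ax h₀)) (⇒L h₂ (ax h₀) (ax h₀)))))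
  ⊢→⊩ ax-⊥E = ⇒R (⊥L h₀)
  ⊢→⊩ (mp d e) = cut _ (⊢→⊩ e) (⇒-inversion (⊢→⊩ d))
  ⊢→⊩ dual∧ = ⇒R (∧L h₀ (◇L (_ ∷ []) (λ { (here refl) → h₀ }) h₁ tt (⇒L h₀ (ax h₁) (ax h₀))))
  ⊢→⊩ (mon□ d) = ⇒R (□R (_ ∷ []) (λ { (here refl) → h₀ }) tt (⇒-inversion (⊢→⊩ d)))
  ⊢→⊩ (mon◇ d) = ⇒R (◇R [] (λ ()) h₀ tt (⇒-inversion (⊢→⊩ d)))
  ⊢→⊩ (N□ n) = □R [] (λ ()) n (⇒R (ax h₀))
  ⊢→⊩ (C□ c) =
    ⇒R (∧L h₀ (□R (_ ∷ _ ∷ []) (λ { (here refl) → h₀ ; (there (here refl)) → h₁ }) c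
                  (∧R (ax h₀) (ax h₁))))
  ⊢→⊩ (K◇ c) = ⇒R (⇒R (◇R (_ ∷ []) (λ { (here refl) → h₁ }) h₀ c (⇒L h₁ (ax h₀) (ax h₀))))
  ⊢→⊩ (P◇ p) = ◇Rᴰ [] (λ ()) (inj₁ p) (⇒R (ax h₀))
  ⊢→⊩ (D d) = ⇒R (◇Rᴰ (_ ∷ []) (λ { (here refl) → h₀ }) d (ax h₀))
  ⊢→⊩ (T□ t) = ⇒R (T□L t h₀ (ax h₀))
  ⊢→⊩ (T◇ t) = ⇒R (T◇R t (ax h₀))

-- The decision procedure

Sequent : Set
Sequent = List Form × Form

_≟ₛ_ : DecidableEquality Sequent
_≟ₛ_ = ×-≡-dec (List-≡-dec _≟_) _≟_

-- For Γ ⊆ U, derivability of Γ ⊩ C depends only on the set of formulas in Γ, represented by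
-- canon Γ (listed in the order of U); so the sequents over U are finitely many.
module Decision (L : WLogic) (U : List Form) (U-closed : SubformulaClosed U) where

  open SubformulaClosed U-closed
  open SideConditions L
  open Calculus L
  open Equivalence L using (⊩→⊢; ⊢→⊩)
  open import Data.List.Membership.DecPropositional _≟_ using (_∈?_)

  canon : List Form → List Form
  canon Γ = filter (_∈? Γ) U

  canon-⊆ : ∀ {Γ} → canon Γ ⊆ Γ
  canon-⊆ {Γ} = proj₂ ∘ ∈-filter⁻ (_∈? Γ) {xs = U}

  ∈-canon : ∀ {A Γ} → A ∈ U → A ∈ Γ → A ∈ canon Γ
  ∈-canon {Γ = Γ} = ∈-filter⁺ (_∈? Γ)

  canon-++ : ∀ Π {Γ Δ} → Δ ⊆ Γ → (∀ {A} → A ∈ U → A ∈ Γ → A ∈ Δ) → canon (Π ++ Δ) ≡ canon (Π ++ Γ)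
  canon-++ Π {Γ} {Δ} Δ⊆Γ Γ⊆Δ = filter-cong (_∈? Π ++ Δ) (_∈? Π ++ Γ) U Π++Δ⊆ Π++Γ⊆
    where
    Π++Δ⊆ : ∀ {A} → A ∈ U → A ∈ Π ++ Δ → A ∈ Π ++ Γ
    Π++Δ⊆ _ A∈ with ∈-++⁻ Π A∈
    ... | inj₁ A∈Π = ∈-++⁺ˡ A∈Π
    ... | inj₂ A∈Δ = ∈-++⁺ʳ Π (Δ⊆Γ A∈Δ)
    Π++Γ⊆ : ∀ {A} → A ∈ U → A ∈ Π ++ Γ → A ∈ Π ++ Δ
    Π++Γ⊆ A∈U A∈ with ∈-++⁻ Π A∈
    ... | inj₁ A∈Π = ∈-++⁺ˡ A∈Π
    ... | inj₂ A∈Γ = ∈-++⁺ʳ Π (Γ⊆Δ A∈U A∈Γ)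

  -- The boxed formulas Σ of a modal rule can be replaced by boxSet Σ, one of finitely many
  -- lists, without breaking its side condition.
  distinctU : List Form
  distinctU = deduplicate _≟_ U

  boxSets : List (List Form)
  boxSets = sublists distinctU

  boxSet : List Form → List Form
  boxSet Σ = filter (_∈? Σ) distinctU

  boxSet∈boxSets : ∀ Σ → boxSet Σ ∈ boxSets
  boxSet∈boxSets Σ = filter∈sublists (_∈? Σ) distinctU

  boxSet-⊆ : ∀ {Σ} → boxSet Σ ⊆ Σ
  boxSet-⊆ {Σ} = proj₂ ∘ ∈-filter⁻ (_∈? Σ) {xs = distinctU}

  ⊆-boxSet : ∀ {Σ} → Σ ⊆ U → Σ ⊆ boxSet Σ
  ⊆-boxSet {Σ} Σ⊆U A∈Σ = ∈-filter⁺ (_∈? Σ) (∈-deduplicate⁺ _≟_ (Σ⊆U A∈Σ)) A∈Σ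

  length-boxSet-⊑ : ∀ {Σ} → Σ ⊆ U → length (boxSet Σ) ⊑ length Σ
  length-boxSet-⊑ {Σ} Σ⊆U = ⊇∧length-≤⇒⊑ (⊆-boxSet Σ⊆U)
    (unique-⊆⇒length-≤ {boxSet Σ} (Unique.filter⁺ (_∈? Σ) (UniqueDec.deduplicate-! _≟_ U)) boxSet-⊆)

  Known : List Sequent → List Form → Form → Set
  Known K Δ C = (canon Δ , C) ∈ K

  known? : ∀ K Δ C → Dec (Known K Δ C)
  known? K Δ C = any? ((canon Δ , C) ≟ₛ_) K

  ⊆□? : ∀ Σ S → Dec (Σ ⊆□ S)
  ⊆□? Σ S = map′ All.lookup All.tabulate (All.all? (λ A → □ A ∈? S) Σ)

  ModalStep : List Sequent → List Form → (ℕ → Set) → List Form → Form → Set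
  ModalStep K S Ok Π B = Any (λ Σ → Σ ⊆□ S × Ok (length Σ) × Known K (Π ++ Σ) B) boxSets

  modalStep? : ∀ K S {Ok} → (∀ n → Dec (Ok n)) → ∀ Π B → Dec (ModalStep K S Ok Π B)
  modalStep? K S ok? Π B = any? (λ Σ → ⊆□? Σ S ×-dec ok? (length Σ) ×-dec known? K (Π ++ Σ) B) boxSets

  RightStep : List Sequent → List Form → Form → Set
  RightStep K S (A ∧′ B) = Known K S A × Known K S B
  RightStep K S (A ∨′ B) = Known K S A ⊎ Known K S B
  RightStep K S (A ⇒ B) = Known K (A ∷ S) B
  RightStep K S (□ B) = ModalStep K S (□R-ok L) [] B
  RightStep K S (◇ B) = T (hasT L) × Known K S B
                      ⊎ Any (λ A → ◇ A ∈ S × ModalStep K S (◇R-ok L) (A ∷ []) B) U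
                      ⊎ ModalStep K S (◇Rᴰ-ok L) [] B
  RightStep K S (var _) = ⊥
  RightStep K S ⊥′ = ⊥

  rightStep? : ∀ K S C → Dec (RightStep K S C)
  rightStep? K S (A ∧′ B) = known? K S A ×-dec known? K S B
  rightStep? K S (A ∨′ B) = known? K S A ⊎-dec known? K S B
  rightStep? K S (A ⇒ B) = known? K (A ∷ S) B
  rightStep? K S (□ B) = modalStep? K S □R-ok? [] B
  rightStep? K S (◇ B) = T? _ ×-dec known? K S B
                       ⊎-dec any? (λ A → ◇ A ∈? S ×-dec modalStep? K S ◇R-ok? (A ∷ []) B) U
                       ⊎-dec modalStep? K S ◇Rᴰ-ok? [] B
  rightStep? K S (var _) = no λ ()
  rightStep? K S ⊥′ = no λ ()

  LeftStep : List Sequent → List Form → Form → Form → Set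
  LeftStep K S C (A ∧′ B) = Known K (A ∷ B ∷ S) C
  LeftStep K S C (A ∨′ B) = Known K (A ∷ S) C × Known K (B ∷ S) C
  LeftStep K S C (A ⇒ B) = Known K S A × Known K (B ∷ S) C
  LeftStep K S C (□ A) = T (hasT L) × Known K (A ∷ S) C
  LeftStep K S C (◇ A) = ModalStep K S (□R-ok L) (A ∷ []) ⊥′
  LeftStep K S C (var _) = ⊥
  LeftStep K S C ⊥′ = ⊥

  leftStep? : ∀ K S C F → Dec (LeftStep K S C F)
  leftStep? K S C (A ∧′ B) = known? K (A ∷ B ∷ S) C
  leftStep? K S C (A ∨′ B) = known? K (A ∷ S) C ×-dec known? K (B ∷ S) C
  leftStep? K S C (A ⇒ B) = known? K S A ×-dec known? K (B ∷ S) C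
  leftStep? K S C (□ A) = T? _ ×-dec known? K (A ∷ S) C
  leftStep? K S C (◇ A) = modalStep? K S □R-ok? (A ∷ []) ⊥′
  leftStep? K S C (var _) = no λ ()
  leftStep? K S C ⊥′ = no λ ()

  Step : List Sequent → List Form → Form → Set
  Step K S C = C ∈ S ⊎ ⊥′ ∈ S ⊎ RightStep K S C ⊎ Any (LeftStep K S C) S ⊎ ModalStep K S (□L-ok L) [] ⊥′

  pattern by-ax p = inj₁ p
  pattern by-⊥L p = inj₂ (inj₁ p)
  pattern by-right r = inj₂ (inj₂ (inj₁ r))
  pattern by-left l = inj₂ (inj₂ (inj₂ (inj₁ l)))
  pattern by-□L m = inj₂ (inj₂ (inj₂ (inj₂ m)))

  step? : ∀ K S C → Dec (Step K S C)
  step? K S C = C ∈? S ⊎-dec ⊥′ ∈? S ⊎-dec rightStep? K S C ⊎-dec any? (leftStep? K S C) S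
                ⊎-dec modalStep? K S □L-ok? [] ⊥′

  module StepSound (K : List Sequent) (K-sound : ∀ {Δ C} → (Δ , C) ∈ K → Δ ⊩ C) where

    known-sound : ∀ {Δ C} → Known K Δ C → Δ ⊩ C
    known-sound k = weaken canon-⊆ (K-sound k)

    modal-sound : ∀ {S} Ok {Π B C} → ModalStep K S Ok Π B →
                  (∀ Σ → Σ ⊆□ S → Ok (length Σ) → Π ++ Σ ⊩ B → S ⊩ C) → S ⊩ C
    modal-sound _ m rule with find m
    ... | Σ , _ , Σ⊆ , ok , k = rule Σ Σ⊆ ok (known-sound k)

    right-sound : ∀ {S} C → RightStep K S C → S ⊩ C
    right-sound (A ∧′ B) (a , b) = ∧R (known-sound a) (known-sound b)
    right-sound (A ∨′ B) (inj₁ a) = ∨R₁ (known-sound a)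
    right-sound (A ∨′ B) (inj₂ b) = ∨R₂ (known-sound b)
    right-sound (A ⇒ B) k = ⇒R (known-sound k)
    right-sound (□ B) m = modal-sound (□R-ok L) m □R
    right-sound (◇ B) (inj₁ (t , k)) = T◇R t (known-sound k)
    right-sound (◇ B) (inj₂ (inj₁ a)) with find a
    ... | A , _ , ◇A∈ , m = modal-sound (◇R-ok L) m (λ Σ Σ⊆ ok d → ◇R Σ Σ⊆ ◇A∈ ok d)
    right-sound (◇ B) (inj₂ (inj₂ m)) = modal-sound (◇Rᴰ-ok L) m ◇Rᴰ

    left-sound : ∀ {S C} F → F ∈ S → LeftStep K S C F → S ⊩ C
    left-sound (A ∧′ B) p k = ∧L p (known-sound k)
    left-sound (A ∨′ B) p (k₁ , k₂) = ∨L p (known-sound k₁) (known-sound k₂)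
    left-sound (A ⇒ B) p (k₁ , k₂) = ⇒L p (known-sound k₁) (known-sound k₂)
    left-sound (□ A) p (t , k) = T□L t p (known-sound k)
    left-sound (◇ A) p m = modal-sound (□R-ok L) m (λ Σ Σ⊆ ok d → ◇L Σ Σ⊆ p ok d)

    step-sound : ∀ {S C} → Step K S C → S ⊩ C
    step-sound (by-ax p) = ax p
    step-sound (by-⊥L p) = ⊥L p
    step-sound (by-right r) = right-sound _ r
    step-sound (by-left l) with find l
    ... | F , F∈ , k = left-sound F F∈ k
    step-sound (by-□L m) = modal-sound (□L-ok L) m □L

  module StepComplete (K : List Sequent)
                      (K-closed : ∀ {S C} → S ∈ sublists U → C ∈ U → Step K S C → (S , C) ∈ K) where

    ++-⊆U : ∀ Π {Γ} → Π ⊆ U → Γ ⊆ U → Π ++ Γ ⊆ U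
    ++-⊆U Π Π⊆U Γ⊆U A∈ with ∈-++⁻ Π A∈
    ... | inj₁ A∈Π = Π⊆U A∈Π
    ... | inj₂ A∈Γ = Γ⊆U A∈Γ

    [_]⊆U : ∀ {A} → A ∈ U → A ∷ [] ⊆ U
    [ A∈U ]⊆U = ∈-∷⁺ʳ A∈U (λ ())

    boxes⊆U : ∀ {Γ Σ} → Γ ⊆ U → Σ ⊆□ Γ → Σ ⊆ U
    boxes⊆U Γ⊆U Σ⊆ = ≺-closed □₁ ∘ Γ⊆U ∘ Σ⊆

    boxSet-⊆□ : ∀ {Γ Σ} → Γ ⊆ U → Σ ⊆□ Γ → boxSet Σ ⊆□ canon Γ
    boxSet-⊆□ Γ⊆U Σ⊆ A∈ = let □A∈Γ = Σ⊆ (boxSet-⊆ A∈) in ∈-canon (Γ⊆U □A∈Γ) □A∈Γ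

    mutual
      known-complete : ∀ {Γ C} → Γ ⊩ C → Γ ⊆ U → C ∈ U → Known K Γ C
      known-complete {Γ} d Γ⊆U C∈U = K-closed (filter∈sublists (_∈? Γ) U) C∈U (step-complete d Γ⊆U C∈U)

      premise : ∀ Π {Γ B} → Π ++ Γ ⊩ B → Π ++ Γ ⊆ U → B ∈ U → Known K (Π ++ canon Γ) B
      premise Π {B = B} d ⊆U B∈U =
        subst (λ S → (S , B) ∈ K) (sym (canon-++ Π canon-⊆ ∈-canon)) (known-complete d ⊆U B∈U)

      modal-premise : ∀ {Γ Ok B} Π Σ → (∀ {m n} → m ⊑ n → Ok n → Ok m) → Γ ⊆ U → Σ ⊆□ Γ →
                      Ok (length Σ) → Π ++ Σ ⊩ B → Π ⊆ U → B ∈ U → ModalStep K (canon Γ) Ok Π B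
      modal-premise {B = B} Π Σ Ok-⊑ Γ⊆U Σ⊆ ok d Π⊆U B∈U =
        lose (boxSet∈boxSets Σ)
          ( boxSet-⊆□ Γ⊆U Σ⊆
          , Ok-⊑ (length-boxSet-⊑ Σ⊆U) ok
          , subst (λ S → (S , B) ∈ K) (sym (canon-++ Π boxSet-⊆ (λ _ → ⊆-boxSet Σ⊆U)))
                  (known-complete d (++-⊆U Π Π⊆U Σ⊆U) B∈U) )
        where
        Σ⊆U = boxes⊆U Γ⊆U Σ⊆

      step-complete : ∀ {Γ C} → Γ ⊩ C → Γ ⊆ U → C ∈ U → Step K (canon Γ) C
      step-complete (ax p) Γ⊆U C∈U = by-ax (∈-canon C∈U p)
      step-complete (⊥L p) Γ⊆U C∈U = by-⊥L (∈-canon ⊥∈ p)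
      step-complete (∧R d e) Γ⊆U C∈U =
        by-right (premise [] d Γ⊆U (≺-closed ∧₁ C∈U) , premise [] e Γ⊆U (≺-closed ∧₂ C∈U))
      step-complete (∨R₁ d) Γ⊆U C∈U = by-right (inj₁ (premise [] d Γ⊆U (≺-closed ∨₁ C∈U)))
      step-complete (∨R₂ d) Γ⊆U C∈U = by-right (inj₂ (premise [] d Γ⊆U (≺-closed ∨₂ C∈U)))
      step-complete (⇒R d) Γ⊆U C∈U =
        by-right (premise (_ ∷ []) d (∈-∷⁺ʳ (≺-closed ⇒₁ C∈U) Γ⊆U) (≺-closed ⇒₂ C∈U))
      step-complete (T◇R t d) Γ⊆U C∈U = by-right (inj₁ (t , premise [] d Γ⊆U (≺-closed ◇₁ C∈U)))
      step-complete (□R Σ Σ⊆ ok d) Γ⊆U C∈U =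
        by-right (modal-premise [] Σ □R-ok-⊑ Γ⊆U Σ⊆ ok d (λ ()) (≺-closed □₁ C∈U))
      step-complete (◇R Σ Σ⊆ p ok d) Γ⊆U C∈U =
        by-right (inj₂ (inj₁ (lose A∈U (∈-canon (Γ⊆U p) p ,
          modal-premise (_ ∷ []) Σ ◇R-ok-⊑ Γ⊆U Σ⊆ ok d [ A∈U ]⊆U (≺-closed ◇₁ C∈U)))))
        where A∈U = ≺-closed ◇₁ (Γ⊆U p)
      step-complete (◇Rᴰ Σ Σ⊆ ok d) Γ⊆U C∈U =
        by-right (inj₂ (inj₂ (modal-premise [] Σ ◇Rᴰ-ok-⊑ Γ⊆U Σ⊆ ok d (λ ()) (≺-closed ◇₁ C∈U))))
      step-complete (∧L p d) Γ⊆U C∈U =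
        by-left (lose (∈-canon (Γ⊆U p) p)
          (premise (_ ∷ _ ∷ []) d (∈-∷⁺ʳ (≺-closed ∧₁ (Γ⊆U p)) (∈-∷⁺ʳ (≺-closed ∧₂ (Γ⊆U p)) Γ⊆U)) C∈U))
      step-complete (∨L p d e) Γ⊆U C∈U =
        by-left (lose (∈-canon (Γ⊆U p) p)
          ( premise (_ ∷ []) d (∈-∷⁺ʳ (≺-closed ∨₁ (Γ⊆U p)) Γ⊆U) C∈U
          , premise (_ ∷ []) e (∈-∷⁺ʳ (≺-closed ∨₂ (Γ⊆U p)) Γ⊆U) C∈U ))
      step-complete (⇒L p d e) Γ⊆U C∈U =
        by-left (lose (∈-canon (Γ⊆U p) p)
          ( premise [] d Γ⊆U (≺-closed ⇒₁ (Γ⊆U p))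
          , premise (_ ∷ []) e (∈-∷⁺ʳ (≺-closed ⇒₂ (Γ⊆U p)) Γ⊆U) C∈U ))
      step-complete (T□L t p d) Γ⊆U C∈U =
        by-left (lose (∈-canon (Γ⊆U p) p) (t , premise (_ ∷ []) d (∈-∷⁺ʳ (≺-closed □₁ (Γ⊆U p)) Γ⊆U) C∈U))
      step-complete (◇L Σ Σ⊆ p ok d) Γ⊆U C∈U =
        by-left (lose (∈-canon (Γ⊆U p) p)
          (modal-premise (_ ∷ []) Σ □R-ok-⊑ Γ⊆U Σ⊆ ok d [ ≺-closed ◇₁ (Γ⊆U p) ]⊆U ⊥∈))
      step-complete (□L Σ Σ⊆ ok d) Γ⊆U C∈U =
        by-□L (modal-premise [] Σ □L-ok-⊑ Γ⊆U Σ⊆ ok d (λ ()) ⊥∈)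

  sequents : List Sequent
  sequents = cartesianProduct (sublists U) U

  Derivable : Sequent → Set
  Derivable (Γ , C) = Γ ⊩ C

  StepOn : List Sequent → Sequent → Set
  StepOn K (S , C) = Step K S C

  stepOn? : ∀ K x → Dec (StepOn K x)
  stepOn? K (S , C) = step? K S C

  step-preserves : ∀ {K x} → (∀ {y} → y ∈ K → Derivable y) → StepOn K x → Derivable x
  step-preserves {K} {S , C} K-sound = StepSound.step-sound K K-sound

  open Saturation _≟ₛ_ sequents StepOn stepOn?

  decide : ∀ A → A ∈ U → Dec (L ⊢ A)
  decide A A∈U with known? saturated [] A
  ... | yes known = yes (⊩→⊢ (weaken canon-⊆ (saturated-sound Derivable step-preserves known)))
  ... | no ¬known = no λ ⊢A → ¬known (StepComplete.known-complete saturated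
          (λ S∈ C∈ → saturated-closed (∈-cartesianProduct⁺ S∈ C∈)) (⊢→⊩ ⊢A) (λ ()) A∈U)

theorem3p8 : (L : WLogic) (A : Form) → Dec (L ⊢ A)
theorem3p8 L A = decide A (there (∈-subformulas A))
  where open Decision L (⊥′ ∷ subformulas A) (subformulas-closed A)
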